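{- Let $h,k,d$ be integers with $h\ge1$, $k\ge1$, $\gcd(h,k)=1$, $d\ge1$, and put $N=h+k$. The periodic permutation matrices (PPMs) of type $(h,k)$ of size $d$ are exactly the following (block diagonal matrices are written $\mathrm{diag}(\cdot)$; $\mathrm{antidiag}(X_1,\dots,X_s;Y)$ denotes the block matrix whose block rows, from top to bottom, contain $X_1,\dots,X_s,Y$ respectively, with $X_1$ in the last block column, $X_2$ in the next-to-last, etc., and $Y$ in the first block column, all other blocks zero; $\mathrm{antidiag}(X_1,\dots,X_s)$ is the same without $Y$). Case $h\ge2,k\ge2$: (a) if $d=\ell N+1$ ($\ell\ge0$): $\mathrm{diag}(A_1,\dots,A_1,I_1)$ and $\mathrm{antidiag}(B_1,\dots,B_1;I_1)$ (with $\ell$ copies of $A_1$, resp. $B_1$); (b) if $d=\ell N+N-1$ ($\ell\ge0$): $\mathrm{diag}(A_k,\dots,A_k,K)$ and $\mathrm{antidiag}(B_h,\dots,B_h;K)$ ($\ell$ copies); (c) if $d=\ell N$ ($\ell\ge1$): $\mathrm{diag}(A_m,\dots,A_m)$ for $m=1,\dots,k$ and $\mathrm{antidiag}(B_m,\dots,B_m)$ for $m=1,\dots,h$ ($\ell$ copies); and there is no PPM of type $(h,k)$ of size $d$ when $d\not\equiv 0,\pm1\pmod N$. Case $h=1$, $k\ge1$: (a) if $d=\ell N+m$ ($\ell\ge0$, $1\le m\le k$): $\mathrm{diag}(A_m,\dots,A_m,J_m)$ and $\mathrm{antidiag}(B_1,\dots,B_1;J_m)$; (b) if $d=\ell N$ ($\ell\ge1$):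 $\mathrm{diag}(A_m,\dots,A_m)$ for $m=1,\dots,k$ and $\mathrm{antidiag}(B_1,\dots,B_1)$. Case $h\ge1$, $k=1$: (a) if $d=\ell N+m$ ($\ell\ge0$, $1\le m\le h$): $\mathrm{diag}(A_1,\dots,A_1,I_m)$ and $\mathrm{antidiag}(B_m,\dots,B_m;I_m)$; (b) if $d=\ell N$ ($\ell\ge1$): $\mathrm{diag}(A_1,\dots,A_1)$ and $\mathrm{antidiag}(B_m,\dots,B_m)$ for $m=1,\dots,h$. In all cases, $\ell$ denotes the number of copies of the $N\times N$ block, and when $\ell=0$ the two listed matrices coincide.
   Context: A permutation matrix $M$ of size $d$ is given by a permutation $\sigma$ of $\{1,\dots,d\}$ with $M_{i,j}=1$ if $j=\sigma(i)$ and $0$ otherwise. For integers $h,k\ge1$ with $\gcd(h,k)=1$, $M$ is a periodic permutation matrix (PPM) of type $(h,k)$ of size $d$ if $\sigma(i+1)-\sigma(i)\in\{ -h,k\}$ for all $1\le i\le d-1$. For $N=h+k$ and $m\in\{1,\dots,N\}$, $A_m=A_m(h,k)$ is the $N\times N$ PPM of type $(h,k)$ with $\sigma(1)=m$; equivalently, identifying $\{1,\dots,N\}$ with $\mathbb{Z}/N\mathbb{Z}$, $\sigma(i)\equiv ki+m-k$. Put $B_j=A_{N+1-j}$ for $1\le j\le N$. $K=K(h,k)$ is the $(N-1)\times(N-1)$ matrix such that $A_1=\begin{pmatrix}1&0\\0&K\end{pmatrix}$. $I_d$ is the $d\times d$ identity matrix and $J_d$ the $d\times d$ matrix with ones on the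 anti-diagonal and zeros elsewhere. -}

module Defs where

open import Data.Nat using (ℕ; zero; suc; _+_; _*_; _∸_; _%_; _≡ᵇ_; _<ᵇ_; NonZero)
open import Data.Bool using (Bool; true; false; if_then_else_; _∧_; not)
open import Data.Fin using (Fin; toℕ)
open import Data.Fin.Permutation using (Permutation′; _⟨$⟩ʳ_)
open import Data.List using (List; []; _∷_; _++_; replicate)
open import Data.Product using (Σ; _×_; _,_; proj₁)
open import Data.Sum using (_⊎_)
open import Relation.Binary.PropositionalEquality using (_≡_)

-- Matrices are represented 0-indexed as ℕ → ℕ → ℕ; a matrix "of size d"
-- only has meaningful entries at (r , c) with r , c < d.
Mat : Set
Mat = ℕ → ℕ → ℕ

δ : Bool → ℕ
δ true  = 1
δ false = 0

I : Mat
I r c = δ (r ≡ᵇ c)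

J : ℕ → Mat
J n r c = δ (r + c ≡ᵇ n ∸ 1)

-- A_m(h,k): 1-indexed σ(i) ≡ k i + m - k (mod N);
-- 0-indexed: row r has its 1 in column (k r + m - 1) mod N.
A : (h k : ℕ) → ℕ → Mat
A h k m r c = δ (c ≡ᵇ (k * r + (m ∸ 1)) % suc (h + k ∸ 1))
-- note: suc (h + k ∸ 1) = h + k = N whenever h ≥ 1

B : (h k : ℕ) → ℕ → Mat
B h k j = A h k (h + k + 1 ∸ j)

-- K : A_1 = diag(1, K), K of size N - 1
K : (h k : ℕ) → Mat
K h k r c = A h k 1 (suc r) (suc c)

Block : Set
Block = ℕ × Mat

size : List Block → ℕ
size []            = 0
size ((n , _) ∷ bs) = n + size bs

diag : List Block → Mat
diag [] r c = 0
diag ((n , X) ∷ bs) r c =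
  if (r <ᵇ n) ∧ (c <ᵇ n) then X r c
  else if not (r <ᵇ n) ∧ not (c <ᵇ n) then diag bs (r ∸ n) (c ∸ n)
  else 0

-- block anti-diagonal: block row i (from the top) contains the i-th block,
-- the first block sits in the last block column, the second in the
-- next-to-last, …, and the last block in the first block column.
-- antidiag(X_1,…,X_s;Y) = antidiag (X_1 ∷ … ∷ X_s ∷ Y ∷ []).
antidiag : List Block → Mat
antidiag [] r c = 0
antidiag ((n , X) ∷ bs) r c =
  if r <ᵇ n
  then (if not (c <ᵇ size bs) ∧ (c <ᵇ size bs + n) then X r (c ∸ size bs) else 0)
  else (if c <ᵇ size bs then antidiag bs (r ∸ n) c else 0)

copies : ℕ → Block → List Block
copies ℓ b = replicate ℓ b

_≈M_ : {d : ℕ} → (Fin d → Fin d → ℕ) → Mat → Set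
M ≈M L = ∀ i j → M i j ≡ L (toℕ i) (toℕ j)

IsPermMatOf : {d : ℕ} → (Fin d → Fin d → ℕ) → Permutation′ d → Set
IsPermMatOf M π = ∀ i j → M i j ≡ δ (toℕ j ≡ᵇ toℕ (π ⟨$⟩ʳ i))

IsPPM : (h k d : ℕ) → (Fin d → Fin d → ℕ) → Set
IsPPM h k d M = Σ (Permutation′ d) λ π → IsPermMatOf M π ×
  (∀ (i j : Fin d) → toℕ j ≡ suc (toℕ i) →
     (toℕ (π ⟨$⟩ʳ j) + h ≡ toℕ (π ⟨$⟩ʳ i)) ⊎ (toℕ (π ⟨$⟩ʳ j) ≡ toℕ (π ⟨$⟩ʳ i) + k))

{-# OPTIONS --safe #-}
module Submission where

-- Read a permutation matrix as its 0-indexed permutation σ; being periodic of type (h, k)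
-- means every step σ (i + 1) − σ i is −h or +k. Inside a window of N = h + k consecutive
-- values such a walk is forced to be i ↦ a + (k i + c mod N), the row pattern of a block
-- A_{c+1} (or B_m) shifted by a, and since gcd (N, k) = 1 it fills the window. The first N
-- entries of a walk of length N + d always fill the bottom window [0, N) or the top window
-- [d, d + N), so blocks can be peeled off one at a time; the steps across block boundaries
-- force all blocks to share one offset c, diagonal when c < k and antidiagonal otherwise.
-- What remains is a walk of length t < N, and counting the values from which no step is
-- possible pins it down: for h, k ≥ 2 it is empty, I₁ or K; for h = 1 it is J_t; for k = 1
-- it is I_t. Conversely, the listed matrices are glued from such pieces and every boundary
-- step is a legal one.

open import Defs
open import Data.Bool using (true; false; if_then_else_; T)
open import Data.Bool.Properties using (T-≡; ¬-not)
open import Data.Empty using (⊥; ⊥-elim)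
open import Data.Fin using (Fin; toℕ; fromℕ<; punchOut)
open import Data.Fin.Properties
  using (toℕ-injective; toℕ<n; toℕ-fromℕ<; fromℕ<-toℕ; fromℕ<-cong; injective⇒≤; any?; punchOut-injective)
  renaming (_≟_ to _≟ᶠ_)
open import Data.Fin.Permutation using (Permutation′; _⟨$⟩ʳ_; _⟨$⟩ˡ_; permutation; inverseˡ)
open import Data.List using (List; []; _∷_; _++_)
open import Data.List.Properties using (++-identityʳ)
open import Data.Nat
open import Data.Nat.Coprimality using (Coprime; coprime-divisor; coprime-+; gcd≡1⇒coprime)
open import Data.Nat.DivMod
open import Data.Nat.Divisibility using (_∣_; divides; ∣⇒≤; ∣m+n∣m⇒∣n; n∣m*n)
open import Data.Nat.GCD using (gcd)
open import Data.Nat.Properties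
open import Data.Nat.Tactic.RingSolver using (solve-∀)
open import Data.Product using (∃; _×_; _,_; proj₁; proj₂)
open import Data.Sum using (_⊎_; inj₁; inj₂; [_,_]′)
open import Function using (_∘_)
open import Function.Bundles using (Equivalence; _⇔_; mk⇔)
open import Function.Definitions using (Injective)
open import Relation.Binary.Definitions using (tri<; tri≈; tri>)
open import Relation.Binary.PropositionalEquality hiding (J)
open import Relation.Nullary using (¬_; yes; no; contradiction)
open ≡-Reasoning

<ᵇ-true : ∀ {m n} → m < n → (m <ᵇ n) ≡ true
<ᵇ-true m<n = Equivalence.to T-≡ (<⇒<ᵇ m<n)

<ᵇ-false : ∀ {m n} → n ≤ m → (m <ᵇ n) ≡ false
<ᵇ-false {m} {n} n≤m = ¬-not λ m<ᵇn → ≤⇒≯ n≤m (<ᵇ⇒< m n (Equivalence.from T-≡ m<ᵇn))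

≡ᵇ-sym : ∀ m n → (m ≡ᵇ n) ≡ (n ≡ᵇ m)
≡ᵇ-sym zero    zero    = refl
≡ᵇ-sym zero    (suc n) = refl
≡ᵇ-sym (suc m) zero    = refl
≡ᵇ-sym (suc m) (suc n) = ≡ᵇ-sym m n

+-cancelˡ-≡ᵇ : ∀ o m n → (o + m ≡ᵇ o + n) ≡ (m ≡ᵇ n)
+-cancelˡ-≡ᵇ zero    m n = refl
+-cancelˡ-≡ᵇ (suc o) m n = +-cancelˡ-≡ᵇ o m n

δ-≢ : ∀ {m n} → m ≢ n → δ (m ≡ᵇ n) ≡ 0
δ-≢ {m} {n} m≢n with m ≡ᵇ n in eq
... | false = refl
... | true  = contradiction (≡ᵇ⇒≡ m n (subst T (sym eq) _)) m≢n

δ-∸ : ∀ a c x → a ≤ c → δ (c ∸ a ≡ᵇ x) ≡ δ (c ≡ᵇ a + x)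
δ-∸ a c x a≤c = begin
  δ (c ∸ a ≡ᵇ x)            ≡⟨ cong δ (+-cancelˡ-≡ᵇ a (c ∸ a) x) ⟨
  δ (a + (c ∸ a) ≡ᵇ a + x)  ≡⟨ cong (λ c′ → δ (c′ ≡ᵇ a + x)) (m+[n∸m]≡n a≤c) ⟩
  δ (c ≡ᵇ a + x)            ∎

<2n⇒%-cases : ∀ {n x} .{{_ : NonZero n}} → x < n + n → x ≡ x % n ⊎ x ≡ n + x % n
<2n⇒%-cases {n} {x} x<n+n with x <? n
... | yes x<n = inj₁ (sym (m<n⇒m%n≡m x<n))
... | no x≮n  = inj₂ (sym (begin
  n + x % n          ≡⟨ cong (λ z → n + z % n) n+y≡x ⟨
  n + (n + y) % n    ≡⟨ cong (λ z → n + z % n) (+-comm n y) ⟩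
  n + (y + n) % n    ≡⟨ cong (n +_) ([m+n]%n≡m%n y n) ⟩
  n + y % n          ≡⟨ cong (n +_) (m<n⇒m%n≡m y<n) ⟩
  n + y              ≡⟨ n+y≡x ⟩
  x                  ∎))
  where
  y : ℕ
  y = x ∸ n
  n+y≡x : n + y ≡ x
  n+y≡x = m+[n∸m]≡n (≮⇒≥ x≮n)
  y<n : y < n
  y<n = +-cancelˡ-< n y n (subst (_< n + n) (sym n+y≡x) x<n+n)

suc-% : ∀ {n} .{{_ : NonZero n}} x → suc (x % n) < n → suc x % n ≡ suc (x % n)
suc-% {n} x 1+x%n<n = begin
  (1 + x) % n             ≡⟨ %-distribˡ-+ 1 x n ⟩
  (1 % n + x % n) % n     ≡⟨ cong (λ y → (y + x % n) % n) (m<n⇒m%n≡m (≤-trans (s≤s (s≤s z≤n)) 1+x%n<n)) ⟩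
  suc (x % n) % n         ≡⟨ m<n⇒m%n≡m 1+x%n<n ⟩
  suc (x % n)             ∎

x<a+w⇒x∸a<w : ∀ {a x w} → a ≤ x → x < a + w → x ∸ a < w
x<a+w⇒x∸a<w {a} {x} {w} a≤x x<a+w = +-cancelˡ-< a (x ∸ a) w (subst (_< a + w) (sym (m+[n∸m]≡n a≤x)) x<a+w)

Bounded : ℕ → ℕ → (ℕ → ℕ) → Set
Bounded m n f = ∀ {i} → i < m → f i < n

InjectiveBelow : ℕ → (ℕ → ℕ) → Set
InjectiveBelow m f = ∀ {i j} → i < m → j < m → f i ≡ f j → i ≡ j

injective⇒surjective : ∀ {n} {f : Fin n → Fin n} → Injective _≡_ _≡_ f → ∀ v → ∃ λ i → f i ≡ v
injective⇒surjective {suc n} {f} f-injective v with any? (λ i → f i ≟ᶠ v)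
... | yes found = found
... | no ¬found = contradiction (injective⇒≤ g-injective) (n≮n n)
  where
  missed : ∀ i → v ≢ f i
  missed i v≡fi = ¬found (i , sym v≡fi)
  g : Fin (suc n) → Fin n
  g i = punchOut (missed i)
  g-injective : Injective _≡_ _≡_ g
  g-injective {i} {j} = f-injective ∘ punchOut-injective (missed i) (missed j)

injectiveBelow⇒surjective : ∀ {n f} → Bounded n n f → InjectiveBelow n f →
                            ∀ {v} → v < n → ∃ λ i → i < n × f i ≡ v
injectiveBelow⇒surjective {n} {f} f-bounded f-injective {v} v<n = toℕ i , toℕ<n i , (begin
  f (toℕ i)          ≡⟨ toℕ-fromℕ< _ ⟨
  toℕ (f̂ i)          ≡⟨ cong toℕ (proj₂ hit) ⟩
  toℕ (fromℕ< v<n)   ≡⟨ toℕ-fromℕ< v<n ⟩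
  v                  ∎)
  where
  f̂ : Fin n → Fin n
  f̂ i = fromℕ< (f-bounded (toℕ<n i))
  f̂-injective : Injective _≡_ _≡_ f̂
  f̂-injective {i} {j} f̂i≡f̂j = toℕ-injective (f-injective (toℕ<n i) (toℕ<n j) (begin
    f (toℕ i)   ≡⟨ toℕ-fromℕ< _ ⟨
    toℕ (f̂ i)   ≡⟨ cong toℕ f̂i≡f̂j ⟩
    toℕ (f̂ j)   ≡⟨ toℕ-fromℕ< _ ⟩
    f (toℕ j)   ∎))
  hit : ∃ λ i → f̂ i ≡ fromℕ< v<n
  hit = injective⇒surjective f̂-injective (fromℕ< v<n)
  i : Fin n
  i = proj₁ hit

Step : ℕ → ℕ → ℕ → ℕ → Set
Step h k x y = y + h ≡ x ⊎ y ≡ x + k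

Step-+ˡ : ∀ {h k} a {x y} → Step h k x y → Step h k (a + x) (a + y)
Step-+ˡ {h} a (inj₁ y+h≡x) = inj₁ (trans (+-assoc a _ h) (cong (a +_) y+h≡x))
Step-+ˡ {k = k} a (inj₂ y≡x+k) = inj₂ (trans (cong (a +_) y≡x+k) (sym (+-assoc a _ k)))

Step-∸ : ∀ {h k} a {x y} → a ≤ x → a ≤ y → Step h k x y → Step h k (x ∸ a) (y ∸ a)
Step-∸ {h} a a≤x a≤y (inj₁ y+h≡x) = inj₁ (trans (sym (+-∸-comm h a≤y)) (cong (_∸ a) y+h≡x))
Step-∸ {k = k} a a≤x a≤y (inj₂ y≡x+k) = inj₂ (trans (cong (_∸ a) y≡x+k) (+-∸-comm k a≤x))

-- σ is 0-indexed: a permutation of [0, d), with junk values outside that range.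
record IsPeriodicPerm (h k d : ℕ) (σ : ℕ → ℕ) : Set where
  field
    bounded   : Bounded d d σ
    injective : InjectiveBelow d σ
    step      : ∀ {i} → suc i < d → Step h k (σ i) (σ (suc i))

  surjective : ∀ {v} → v < d → ∃ λ i → i < d × σ i ≡ v
  surjective = injectiveBelow⇒surjective bounded injective

  step-up : ∀ {i} → suc i < d → σ i < h → σ (suc i) ≡ σ i + k
  step-up {i} 1+i<d σi<h with step 1+i<d
  ... | inj₁ σ1+i+h≡σi = contradiction (subst (_< h) (sym σ1+i+h≡σi) σi<h) (m+n≮n (σ (suc i)) h)
  ... | inj₂ σ1+i≡σi+k = σ1+i≡σi+k

  step-down : ∀ {i} → suc i < d → d ≤ σ i + k → σ (suc i) + h ≡ σ i
  step-down {i} 1+i<d d≤σi+k with step 1+i<d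
  ... | inj₁ σ1+i+h≡σi = σ1+i+h≡σi
  ... | inj₂ σ1+i≡σi+k = contradiction (subst (_< d) σ1+i≡σi+k (bounded 1+i<d)) (≤⇒≯ d≤σi+k)

permMat : (ℕ → ℕ) → Mat
permMat σ r c = δ (c ≡ᵇ σ r)

module _ {h k d : ℕ} {M : Fin d → Fin d → ℕ} where

  IsPPM⇒periodicPerm : IsPPM h k d M → ∃ λ σ → IsPeriodicPerm h k d σ × M ≈M permMat σ
  IsPPM⇒periodicPerm (π , π-matrix , π-step) = σ , σ-periodic , σ-matrix
    where
    σ : ℕ → ℕ
    σ n with n <? d
    ... | yes n<d = toℕ (π ⟨$⟩ʳ fromℕ< n<d)
    ... | no _    = 0

    σ-fromℕ< : ∀ {n} (n<d : n < d) → σ n ≡ toℕ (π ⟨$⟩ʳ fromℕ< n<d)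
    σ-fromℕ< {n} n<d with n <? d
    ... | yes n<d′ = cong (λ i → toℕ (π ⟨$⟩ʳ i)) (fromℕ<-cong n n refl n<d′ n<d)
    ... | no n≮d   = contradiction n<d n≮d

    σ-toℕ : ∀ i → σ (toℕ i) ≡ toℕ (π ⟨$⟩ʳ i)
    σ-toℕ i = trans (σ-fromℕ< (toℕ<n i)) (cong (λ j → toℕ (π ⟨$⟩ʳ j)) (fromℕ<-toℕ i (toℕ<n i)))

    σ-matrix : M ≈M permMat σ
    σ-matrix i j = trans (π-matrix i j) (cong (λ x → δ (toℕ j ≡ᵇ x)) (sym (σ-toℕ i)))

    σ-periodic : IsPeriodicPerm h k d σ
    σ-periodic .IsPeriodicPerm.bounded n<d = subst (_< d) (sym (σ-fromℕ< n<d)) (toℕ<n _)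
    σ-periodic .IsPeriodicPerm.injective {i} {j} i<d j<d σi≡σj = begin
      i                                             ≡⟨ toℕ-fromℕ< i<d ⟨
      toℕ (fromℕ< i<d)                              ≡⟨ cong toℕ (inverseˡ π) ⟨
      toℕ (π ⟨$⟩ˡ (π ⟨$⟩ʳ fromℕ< i<d))              ≡⟨ cong (λ x → toℕ (π ⟨$⟩ˡ x)) πi≡πj ⟩
      toℕ (π ⟨$⟩ˡ (π ⟨$⟩ʳ fromℕ< j<d))              ≡⟨ cong toℕ (inverseˡ π) ⟩
      toℕ (fromℕ< j<d)                              ≡⟨ toℕ-fromℕ< j<d ⟩
      j                                             ∎
      where
      πi≡πj : π ⟨$⟩ʳ fromℕ< i<d ≡ π ⟨$⟩ʳ fromℕ< j<d
      πi≡πj = toℕ-injective (trans (sym (σ-fromℕ< i<d)) (trans σi≡σj (σ-fromℕ< j<d)))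
    σ-periodic .IsPeriodicPerm.step {i} 1+i<d =
      subst₂ (Step h k) (sym (σ-fromℕ< i<d)) (sym (σ-fromℕ< 1+i<d))
        (π-step (fromℕ< i<d) (fromℕ< 1+i<d) (trans (toℕ-fromℕ< 1+i<d) (cong suc (sym (toℕ-fromℕ< i<d)))))
      where
      i<d : i < d
      i<d = <-trans (n<1+n i) 1+i<d

  periodicPerm⇒IsPPM : ∀ {σ} → IsPeriodicPerm h k d σ → M ≈M permMat σ → IsPPM h k d M
  periodicPerm⇒IsPPM {σ} σ-periodic σ-matrix = π , π-matrix , π-step
    where
    open IsPeriodicPerm σ-periodic
    to : Fin d → Fin d
    to i = fromℕ< (bounded (toℕ<n i))
    from : Fin d → Fin d
    from v = fromℕ< (proj₁ (proj₂ (surjective (toℕ<n v))))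
    σ-from : ∀ v → σ (toℕ (from v)) ≡ toℕ v
    σ-from v = trans (cong σ (toℕ-fromℕ< _)) (proj₂ (proj₂ (surjective (toℕ<n v))))
    π : Permutation′ d
    π = permutation to from
      (λ v → toℕ-injective (trans (toℕ-fromℕ< _) (σ-from v)))
      (λ i → toℕ-injective (injective (toℕ<n _) (toℕ<n i) (trans (σ-from (to i)) (toℕ-fromℕ< _))))
    π-toℕ : ∀ i → toℕ (π ⟨$⟩ʳ i) ≡ σ (toℕ i)
    π-toℕ i = toℕ-fromℕ< _
    π-matrix : IsPermMatOf M π
    π-matrix i j = trans (σ-matrix i j) (cong (λ x → δ (toℕ j ≡ᵇ x)) (sym (π-toℕ i)))
    π-step : ∀ i j → toℕ j ≡ suc (toℕ i) → Step h k (toℕ (π ⟨$⟩ʳ i)) (toℕ (π ⟨$⟩ʳ j))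
    π-step i j j≡1+i = subst₂ (Step h k) (sym (π-toℕ i)) (sym (trans (π-toℕ j) (cong σ j≡1+i)))
      (step (subst (_< d) j≡1+i (toℕ<n j)))

empty-periodic : ∀ {h k σ} → IsPeriodicPerm h k 0 σ
empty-periodic = record { bounded = λ () ; injective = λ () ; step = λ () }

reverse : ℕ → ℕ → ℕ
reverse t i = t ∸ 1 ∸ i

reverse-periodic : ∀ {k t} → IsPeriodicPerm 1 k t (reverse t)
reverse-periodic {t = zero}   = empty-periodic
reverse-periodic {t = suc t′} = record
  { bounded   = λ {i} _ → s≤s (m∸n≤m t′ i)
  ; injective = λ i<t j<t → ∸-cancelˡ-≡ (s≤s⁻¹ i<t) (s≤s⁻¹ j<t)
  ; step      = λ {i} 1+i<t → inj₁ (trans (+-comm (t′ ∸ suc i) 1) (sym (+-∸-assoc 1 (s≤s⁻¹ 1+i<t))))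
  }

identity-periodic : ∀ {h t} → IsPeriodicPerm h 1 t (λ i → i)
identity-periodic = record
  { bounded   = λ i<t → i<t
  ; injective = λ _ _ i≡j → i≡j
  ; step      = λ {i} _ → inj₂ (+-comm 1 i)
  }

singleton-periodic : ∀ {h k σ} → σ 0 ≡ 0 → IsPeriodicPerm h k 1 σ
singleton-periodic σ0≡0 = record
  { bounded   = λ { {zero} _ → subst (_< 1) (sym σ0≡0) z<s ; {suc _} (s≤s ()) }
  ; injective = λ i<1 j<1 _ → trans (n<1⇒n≡0 i<1) (sym (n<1⇒n≡0 j<1))
  ; step      = λ { (s≤s ()) }
  }

drop-first : ∀ {h k n σ} → IsPeriodicPerm h k (suc n) σ → σ 0 ≡ 0 → IsPeriodicPerm h k n (λ i → σ (suc i) ∸ 1)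
drop-first {h} {k} {n} {σ} σ-periodic σ0≡0 = record
  { bounded   = λ i<n → ∸-monoˡ-< (bounded (s≤s i<n)) (positive i<n)
  ; injective = λ i<n j<n eq → suc-injective
      (injective (s≤s i<n) (s≤s j<n) (∸-cancelʳ-≡ (positive i<n) (positive j<n) eq))
  ; step      = λ {i} 1+i<n → Step-∸ 1 (positive (<-trans (n<1+n i) 1+i<n)) (positive 1+i<n) (step (s≤s 1+i<n))
  }
  where
  open IsPeriodicPerm σ-periodic
  positive : ∀ {i} → i < n → 1 ≤ σ (suc i)
  positive {i} i<n with σ (suc i) in eq
  ... | suc _ = s≤s z≤n
  ... | zero  = contradiction (injective (s≤s i<n) z<s (trans eq (sym σ0≡0))) λ ()

-- Gluing two walks

_≗[_]_ : (ℕ → ℕ) → ℕ → (ℕ → ℕ) → Set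
f ≗[ n ] g = ∀ {i} → i < n → f i ≡ g i

data Position (n d : ℕ) : ℕ → Set where
  left  : ∀ {i} → i < n → Position n d i
  right : ∀ {j} → j < d → Position n d (n + j)

position : ∀ n {d i} → i < n + d → Position n d i
position n {d} {i} i<n+d with i <? n
... | yes i<n = left i<n
... | no i≮n  = subst (Position n d) n+[i∸n]≡i (right (+-cancelˡ-< n _ _ (subst (_< n + d) (sym n+[i∸n]≡i) i<n+d)))
  where
  n+[i∸n]≡i : n + (i ∸ n) ≡ i
  n+[i∸n]≡i = m+[n∸m]≡n (≮⇒≥ i≮n)

-- Opaque, so that unification sees the arguments of glue rather than an unfolded
-- if_then_else_.
opaque
  glue : ℕ → ℕ → ℕ → (ℕ → ℕ) → (ℕ → ℕ) → ℕ → ℕ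
  glue n a b f g i = if i <ᵇ n then a + f i else b + g (i ∸ n)

module _ {n a b : ℕ} {f g : ℕ → ℕ} where

  opaque
    unfolding glue

    glue-< : ∀ {i} → i < n → glue n a b f g i ≡ a + f i
    glue-< i<n rewrite <ᵇ-true i<n = refl

    glue-+ : ∀ j → glue n a b f g (n + j) ≡ b + g j
    glue-+ j rewrite <ᵇ-false {n + j} (m≤m+n n j) | m+n∸m≡n n j = refl

  permMat-glue-< : ∀ {i} c → i < n → permMat (glue n a b f g) i c ≡ δ (c ≡ᵇ a + f i)
  permMat-glue-< c i<n = cong (λ x → δ (c ≡ᵇ x)) (glue-< i<n)

  permMat-glue-+ : ∀ j c → permMat (glue n a b f g) (n + j) c ≡ δ (c ≡ᵇ b + g j)
  permMat-glue-+ j c = cong (λ x → δ (c ≡ᵇ x)) (glue-+ j)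

  ≗-glue : ∀ {d σ} → (∀ {i} → i < n → σ i ≡ a + f i) → (∀ {j} → j < d → σ (n + j) ≡ b + g j) →
           σ ≗[ n + d ] glue n a b f g
  ≗-glue σ-left σ-right i<n+d with position n i<n+d
  ... | left i<n  = trans (σ-left i<n) (sym (glue-< i<n))
  ... | right j<d = trans (σ-right j<d) (sym (glue-+ _))

  glue-left : ∀ {d σ i} → σ ≗[ n + d ] glue n a b f g → i < n → σ i ≡ a + f i
  glue-left σ≗ i<n = trans (σ≗ (<-≤-trans i<n (m≤m+n n _))) (glue-< i<n)

  glue-right : ∀ {d σ j} → σ ≗[ n + d ] glue n a b f g → j < d → σ (n + j) ≡ b + g j
  glue-right σ≗ j<d = trans (σ≗ (+-monoʳ-< n j<d)) (glue-+ _)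

  glue-bounded : ∀ {d} → Bounded n n f → Bounded d d g → a + n ≤ n + d → b + d ≤ n + d →
                 Bounded (n + d) (n + d) (glue n a b f g)
  glue-bounded f-bounded g-bounded a+n≤n+d b+d≤n+d i<n+d with position n i<n+d
  ... | left i<n  = subst (_< _) (sym (glue-< i<n)) (<-≤-trans (+-monoʳ-< a (f-bounded i<n)) a+n≤n+d)
  ... | right j<d = subst (_< _) (sym (glue-+ _)) (<-≤-trans (+-monoʳ-< b (g-bounded j<d)) b+d≤n+d)

  glue-periodic : ∀ {h k d} → IsPeriodicPerm h k n f → IsPeriodicPerm h k d g →
                  a + n ≤ b ⊎ b + d ≤ a → a + n ≤ n + d → b + d ≤ n + d →
                  (0 < d → Step h k (a + f (n ∸ 1)) (b + g 0)) →
                  IsPeriodicPerm h k (n + d) (glue n a b f g)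
  glue-periodic {h} {k} {d} f-periodic g-periodic disjoint a+n≤n+d b+d≤n+d junction = record
    { bounded = glue-bounded F.bounded G.bounded a+n≤n+d b+d≤n+d ; injective = injective ; step = step }
    where
    module F = IsPeriodicPerm f-periodic
    module G = IsPeriodicPerm g-periodic

    apart : ∀ {i j} → i < n → j < d → a + f i ≢ b + g j
    apart {i} {j} i<n j<d eq = [ below , above ]′ disjoint
      where
      below : a + n ≤ b → ⊥
      below a+n≤b = <⇒≱ (<-≤-trans (+-monoʳ-< a (F.bounded i<n)) a+n≤b)
          (≤-trans (m≤m+n b (g j)) (≤-reflexive (sym eq)))
      above : b + d ≤ a → ⊥
      above b+d≤a = <⇒≱ (<-≤-trans (+-monoʳ-< b (G.bounded j<d)) b+d≤a) (≤-trans (m≤m+n a (f i)) (≤-reflexive eq))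

    injective : InjectiveBelow (n + d) (glue n a b f g)
    injective i<n+d j<n+d eq with position n i<n+d | position n j<n+d
    ... | left i<n  | left j<n  = F.injective i<n j<n
        (+-cancelˡ-≡ a _ _ (trans (sym (glue-< i<n)) (trans eq (glue-< j<n))))
    ... | left i<n  | right j<d = contradiction (trans (sym (glue-< i<n)) (trans eq (glue-+ _))) (apart i<n j<d)
    ... | right i<d | left j<n  = contradiction (trans (sym (glue-< j<n)) (trans (sym eq) (glue-+ _))) (apart j<n i<d)
    ... | right i<d | right j<d = cong (n +_)
        (G.injective i<d j<d (+-cancelˡ-≡ b _ _ (trans (sym (glue-+ _)) (trans eq (glue-+ _)))))

    step : ∀ {i} → suc i < n + d → Step h k (glue n a b f g i) (glue n a b f g (suc i))
    step {i} 1+i<n+d with position n (<-trans (n<1+n i) 1+i<n+d)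
    step {i} 1+i<n+d | left i<n with suc i <? n
    ... | yes 1+i<n = subst₂ (Step h k) (sym (glue-< i<n)) (sym (glue-< 1+i<n)) (Step-+ˡ a (F.step 1+i<n))
    ... | no 1+i≮n  = subst₂ (Step h k) (sym (glue-< i<n)) (sym (trans (cong (glue n a b f g) 1+i≡n+0) (glue-+ 0)))
                        (junction′ (≤-antisym i<n (≮⇒≥ 1+i≮n)))
      where
      1+i≡n+0 : suc i ≡ n + 0
      1+i≡n+0 = trans (≤-antisym i<n (≮⇒≥ 1+i≮n)) (sym (+-identityʳ n))
      junction′ : suc i ≡ n → Step h k (a + f i) (b + g 0)
      junction′ refl = junction (+-cancelˡ-< n 0 d (subst (_< n + d) 1+i≡n+0 1+i<n+d))
    step 1+i<n+d | right {j} j<d =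
      subst₂ (Step h k) (sym (glue-+ j)) (sym (trans (cong (glue n a b f g) (sym (+-suc n j))) (glue-+ (suc j))))
        (Step-+ˡ b (G.step (+-cancelˡ-< n _ _ (subst (_< n + d) (sym (+-suc n j)) 1+i<n+d))))

≗-glue-cong : ∀ {n d a b f g a′ b′ f′ g′ σ} → σ ≗[ n + d ] glue n a b f g →
              (∀ {i} → i < n → a + f i ≡ a′ + f′ i) → (∀ {j} → j < d → b + g j ≡ b′ + g′ j) →
              σ ≗[ n + d ] glue n a′ b′ f′ g′
≗-glue-cong σ≗ f≗f′ g≗g′ = ≗-glue (λ i<n → trans (glue-left σ≗ i<n) (f≗f′ i<n))
    (λ j<d → trans (glue-right σ≗ j<d) (g≗g′ j<d))

glue-junction : ∀ {h k n d a b f g σ} → IsPeriodicPerm h k (suc n + d) σ → σ ≗[ suc n + d ] glue (suc n) a b f g →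
                0 < d → Step h k (a + f n) (b + g 0)
glue-junction {h} {k} {n} {d} {σ = σ} σ-periodic σ≗ 0<d =
  subst₂ (Step h k) (glue-left σ≗ (n<1+n n)) (trans (cong σ (sym (+-identityʳ (suc n)))) (glue-right σ≗ 0<d))
    (IsPeriodicPerm.step σ-periodic (m<m+n (suc n) 0<d))

Within : ℕ → ℕ → ℕ → (ℕ → ℕ) → Set
Within n a w σ = ∀ {i} → i < n → a ≤ σ i × σ i < a + w

module _ {D : ℕ} {σ : ℕ → ℕ} where

  -- If P held at σ i it would hold from i on, so the preimages of the n values B v would
  -- all lie below i.
  persistent⇒avoidsPrefix : ∀ {n B} {P : ℕ → Set} →
    (∀ {v} → v < D → ∃ λ i → i < D × σ i ≡ v) →
    (∀ {i} → suc i < D → P (σ i) → P (σ (suc i))) →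
    Bounded n D B → InjectiveBelow n B → (∀ {v} → v < n → ¬ P (B v)) →
    ∀ {i} → i < n → ¬ P (σ i)
  persistent⇒avoidsPrefix {n} {B} {P} σ-surjective P-persists B-bounded B-injective ¬PB {i} i<n Pσi =
    <⇒≱ i<n (injective⇒≤ preimage-injective)
    where
    persists : ∀ o → i + o < D → P (σ (i + o))
    persists zero    _       = subst (P ∘ σ) (sym (+-identityʳ i)) Pσi
    persists (suc o) i+1+o<D = subst (P ∘ σ) (sym (+-suc i o))
        (P-persists 1+i+o<D (persists o (<-trans (n<1+n _) 1+i+o<D)))
      where
      1+i+o<D : suc (i + o) < D
      1+i+o<D = subst (_< D) (+-suc i o) i+1+o<D
    persists-from : ∀ {j} → i ≤ j → j < D → P (σ j)
    persists-from {j} i≤j j<D = subst (P ∘ σ) (m+[n∸m]≡n i≤j)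
        (persists (j ∸ i) (subst (_< D) (sym (m+[n∸m]≡n i≤j)) j<D))
    preimage : Fin n → ℕ
    preimage v = proj₁ (σ-surjective (B-bounded (toℕ<n v)))
    preimage<D : ∀ v → preimage v < D
    preimage<D v = proj₁ (proj₂ (σ-surjective (B-bounded (toℕ<n v))))
    σ-preimage : ∀ v → σ (preimage v) ≡ B (toℕ v)
    σ-preimage v = proj₂ (proj₂ (σ-surjective (B-bounded (toℕ<n v))))
    preimage<i : ∀ v → preimage v < i
    preimage<i v with i ≤? preimage v
    ... | no i≰p  = ≰⇒> i≰p
    ... | yes i≤p = contradiction (subst P (σ-preimage v) (persists-from i≤p (preimage<D v))) (¬PB (toℕ<n v))
    preimage′ : Fin n → Fin i
    preimage′ v = fromℕ< (preimage<i v)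
    preimage-injective : Injective _≡_ _≡_ preimage′
    preimage-injective {v} {w} eq = toℕ-injective (B-injective (toℕ<n v) (toℕ<n w) (begin
      B (toℕ v)          ≡⟨ σ-preimage v ⟨
      σ (preimage v)     ≡⟨ cong σ
          (trans (sym (toℕ-fromℕ< (preimage<i v))) (trans (cong toℕ eq) (toℕ-fromℕ< (preimage<i w)))) ⟩
      σ (preimage w)     ≡⟨ σ-preimage w ⟩
      B (toℕ w)          ∎))

  window-exhausted : ∀ {n a} → InjectiveBelow D σ → n ≤ D → Within n a n σ →
                     ∀ {j} → n ≤ j → j < D → a ≤ σ j → σ j < a + n → ⊥
  window-exhausted {n} {a} σ-injective n≤D σ-within {j} n≤j j<D a≤σj σj<a+n =
    <⇒≱ (subst (_< n) (σ-injective (<-≤-trans i<n n≤D) j<D (∸-cancelʳ-≡ (proj₁ (σ-within i<n)) a≤σj ui≡uj)) i<n) n≤j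
    where
    u : ℕ → ℕ
    u i = σ i ∸ a
    u<n : ∀ {i} → a ≤ σ i → σ i < a + n → u i < n
    u<n = x<a+w⇒x∸a<w
    u-injective : InjectiveBelow n u
    u-injective i<n j<n eq = σ-injective (<-≤-trans i<n n≤D) (<-≤-trans j<n n≤D)
                               (∸-cancelʳ-≡ (proj₁ (σ-within i<n)) (proj₁ (σ-within j<n)) eq)
    hit : ∃ λ i → i < n × u i ≡ u j
    hit = injectiveBelow⇒surjective (λ i<n → u<n (proj₁ (σ-within i<n)) (proj₂ (σ-within i<n))) u-injective
        (u<n a≤σj σj<a+n)
    i : ℕ
    i = proj₁ hit
    i<n : i < n
    i<n = proj₁ (proj₂ hit)
    ui≡uj : u i ≡ u j
    ui≡uj = proj₂ (proj₂ hit)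

suffix-periodic : ∀ {h k n d b σ} → IsPeriodicPerm h k (n + d) σ → Within d b d (λ j → σ (n + j)) →
                  IsPeriodicPerm h k d (λ j → σ (n + j) ∸ b)
suffix-periodic {h} {k} {n} {d} {b} {σ} σ-periodic rest-within = record
  { bounded   = λ j<d → x<a+w⇒x∸a<w (proj₁ (rest-within j<d)) (proj₂ (rest-within j<d))
  ; injective = λ i<d j<d eq → +-cancelˡ-≡ n _ _ (injective (+-monoʳ-< n i<d) (+-monoʳ-< n j<d)
                  (∸-cancelʳ-≡ (proj₁ (rest-within i<d)) (proj₁ (rest-within j<d)) eq))
  ; step      = λ {j} 1+j<d → Step-∸ b (proj₁ (rest-within (<-trans (n<1+n j) 1+j<d))) (proj₁ (rest-within 1+j<d))
                  (subst (λ i → Step h k (σ (n + j)) (σ i)) (sym (+-suc n j))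
                      (step (subst (_< n + d) (+-suc n j) (+-monoʳ-< n 1+j<d))))
  }
  where open IsPeriodicPerm σ-periodic

_≈[_]_ : Mat → ℕ → Mat → Set
X ≈[ n ] Y = ∀ {r} c → r < n → X r c ≡ Y r c

module _ {n : ℕ} {X : Mat} {f : ℕ → ℕ} (X≈f : X ≈[ n ] permMat f) (f-bounded : Bounded n n f) where

  diag-glue : ∀ {bs g} → diag bs ≈[ size bs ] permMat g →
              diag ((n , X) ∷ bs) ≈[ n + size bs ] permMat (glue n 0 n f g)
  diag-glue {bs} {g} bs≈g c r<n+s with position n r<n+s | c <? n
  ... | left {r} r<n | yes c<n rewrite <ᵇ-true r<n | <ᵇ-true c<n =
    trans (X≈f c r<n) (sym (permMat-glue-< c r<n))
  ... | left {r} r<n | no c≮n rewrite <ᵇ-true r<n | <ᵇ-false (≮⇒≥ c≮n) =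
    trans (sym (δ-≢ λ c≡fr → c≮n (subst (_< n) (sym c≡fr) (f-bounded r<n)))) (sym (permMat-glue-< c r<n))
  ... | right {j} j<s | yes c<n rewrite <ᵇ-false {n + j} (m≤m+n n j) | m+n∸m≡n n j | <ᵇ-true c<n =
    trans (sym (δ-≢ λ c≡n+gj → <⇒≱ c<n (subst (n ≤_) (sym c≡n+gj) (m≤m+n n (g j))))) (sym (permMat-glue-+ j c))
  ... | right {j} j<s | no c≮n rewrite <ᵇ-false {n + j} (m≤m+n n j) | m+n∸m≡n n j | <ᵇ-false (≮⇒≥ c≮n) =
    trans (trans (bs≈g (c ∸ n) j<s) (δ-∸ n c (g j) (≮⇒≥ c≮n))) (sym (permMat-glue-+ j c))

  antidiag-glue : ∀ {bs g} → antidiag bs ≈[ size bs ] permMat g → Bounded (size bs) (size bs) g →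
                  antidiag ((n , X) ∷ bs) ≈[ n + size bs ] permMat (glue n (size bs) 0 f g)
  antidiag-glue {bs} {g} bs≈g g-bounded c r<n+s with position n r<n+s | c <? size bs | c <? size bs + n
  ... | left {r} r<n | yes c<s | _ rewrite <ᵇ-true r<n | <ᵇ-true c<s =
    trans (sym (δ-≢ λ c≡s+fr → <⇒≱ c<s (subst (size bs ≤_) (sym c≡s+fr) (m≤m+n (size bs) (f r)))))
        (sym (permMat-glue-< c r<n))
  ... | left {r} r<n | no c≮s | yes c<s+n rewrite <ᵇ-true r<n | <ᵇ-false (≮⇒≥ c≮s) | <ᵇ-true c<s+n =
    trans (trans (X≈f (c ∸ size bs) r<n) (δ-∸ (size bs) c (f r) (≮⇒≥ c≮s))) (sym (permMat-glue-< c r<n))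
  ... | left {r} r<n | no c≮s | no c≮s+n rewrite <ᵇ-true r<n | <ᵇ-false (≮⇒≥ c≮s) | <ᵇ-false (≮⇒≥ c≮s+n) =
    trans (sym (δ-≢ λ c≡s+fr → c≮s+n (subst (_< size bs + n) (sym c≡s+fr) (+-monoʳ-< (size bs) (f-bounded r<n)))))
          (sym (permMat-glue-< c r<n))
  ... | right {j} j<s | yes c<s | _ rewrite <ᵇ-false {n + j} (m≤m+n n j) | m+n∸m≡n n j | <ᵇ-true c<s =
    trans (bs≈g c j<s) (sym (permMat-glue-+ j c))
  ... | right {j} j<s | no c≮s | _ rewrite <ᵇ-false {n + j} (m≤m+n n j) | m+n∸m≡n n j | <ᵇ-false (≮⇒≥ c≮s) =
    trans (sym (δ-≢ λ c≡gj → c≮s (subst (_< size bs) (sym c≡gj) (g-bounded j<s)))) (sym (permMat-glue-+ j c))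

diag-single : ∀ {t X T} → X ≈[ t ] permMat T → Bounded t t T → diag ((t , X) ∷ []) ≈[ t + 0 ] permMat T
diag-single {t} X≈T T-bounded {r} c r<t+0 =
  trans (diag-glue X≈T T-bounded {bs = []} {g = λ _ → 0} (λ _ ()) c r<t+0)
      (permMat-glue-< c (subst (r <_) (+-identityʳ t) r<t+0))

antidiag-single : ∀ {t X T} → X ≈[ t ] permMat T → Bounded t t T → antidiag ((t , X) ∷ []) ≈[ t + 0 ] permMat T
antidiag-single {t} X≈T T-bounded {r} c r<t+0 =
  trans (antidiag-glue X≈T T-bounded {bs = []} {g = λ _ → 0} (λ _ ()) (λ ()) c r<t+0)
      (permMat-glue-< c (subst (r <_) (+-identityʳ t) r<t+0))

size-copies : ∀ ℓ {n X} rest → size (copies ℓ (n , X) ++ rest) ≡ ℓ * n + size rest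
size-copies zero    rest = refl
size-copies (suc ℓ) {n} rest = trans (cong (n +_) (size-copies ℓ rest)) (sym (+-assoc n (ℓ * n) (size rest)))

≈-resize : ∀ {m n X Y} → m ≡ n → X ≈[ m ] Y → X ≈[ n ] Y
≈-resize refl X≈Y = X≈Y

module _ {d : ℕ} {M : Fin d → Fin d → ℕ} {L : Mat} where

  ≈M-via : ∀ {σ τ} → M ≈M permMat σ → σ ≗[ d ] τ → L ≈[ d ] permMat τ → M ≈M L
  ≈M-via M≈σ σ≗τ L≈τ i j =
    trans (M≈σ i j) (trans (cong (λ x → δ (toℕ j ≡ᵇ x)) (σ≗τ (toℕ<n i))) (sym (L≈τ (toℕ j) (toℕ<n i))))

  ≈M-permMat : ∀ {τ} → M ≈M L → L ≈[ d ] permMat τ → M ≈M permMat τ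
  ≈M-permMat M≈L L≈τ i j = trans (M≈L i j) (L≈τ (toℕ j) (toℕ<n i))

I-≈ : ∀ {t T} → (∀ {i} → i < t → T i ≡ i) → I ≈[ t ] permMat T
I-≈ {T = T} Ti≡i {r} c r<t = trans (cong δ (≡ᵇ-sym r c)) (cong (λ x → δ (c ≡ᵇ x)) (sym (Ti≡i r<t)))

I≈[1] : ∀ {T} → T 0 ≡ 0 → I ≈[ 1 ] permMat T
I≈[1] {T} T0≡0 = I-≈ {T = T} λ { {zero} _ → T0≡0 ; {suc _} (s≤s ()) }

J-≈ : ∀ {t T} → (∀ {i} → i < t → i + T i ≡ t ∸ 1) → J t ≈[ t ] permMat T
J-≈ {t} {T} i+Ti≡t-1 {r} c r<t = trans (cong (λ x → δ (r + c ≡ᵇ x)) (sym (i+Ti≡t-1 r<t)))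
    (cong δ (+-cancelˡ-≡ᵇ r c (T r)))

J≈reverse : ∀ {t} → J t ≈[ t ] permMat (reverse t)
J≈reverse {suc t} = J-≈ λ i<t → m+[n∸m]≡n (s≤s⁻¹ i<t)

id-bounded : ∀ {n} → Bounded n n (λ i → i)
id-bounded i<n = i<n

reversed-tail : ∀ {k t T} → IsPeriodicPerm 1 k t T → t ≤ k → ∀ {i} → i < t → i + T i ≡ t ∸ 1
reversed-tail {k} {suc t} {T} T-periodic t≤k i<t =
  trans (i+Ti≡T0 i<t) (≤-antisym (s≤s⁻¹ (bounded z<s)) (subst (t ≤_) (i+Ti≡T0 (n<1+n t)) (m≤m+n t (T t))))
  where
  open IsPeriodicPerm T-periodic
  i+Ti≡T0 : ∀ {i} → i < suc t → i + T i ≡ T 0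
  i+Ti≡T0 {zero}  _     = refl
  i+Ti≡T0 {suc i} 1+i<t = begin
    suc i + T (suc i)    ≡⟨ +-suc i (T (suc i)) ⟨
    i + suc (T (suc i))  ≡⟨ cong (i +_) (+-comm 1 (T (suc i))) ⟩
    i + (T (suc i) + 1)  ≡⟨ cong (i +_) (step-down 1+i<t (≤-trans t≤k (m≤n+m k (T i)))) ⟩
    i + T i              ≡⟨ i+Ti≡T0 (<-trans (n<1+n i) 1+i<t) ⟩
    T 0                  ∎

identity-tail : ∀ {h t T} → IsPeriodicPerm h 1 t T → t ≤ h → ∀ {i} → i < t → T i ≡ i
identity-tail {h} {suc t} {T} T-periodic t≤h i<t =
  trans (Ti≡T0+i i<t) (cong (_+ _)
      (n<1⇒n≡0 (+-cancelʳ-< t (T 0) 1 (subst (_< suc t) (Ti≡T0+i (n<1+n t)) (bounded (n<1+n t))))))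
  where
  open IsPeriodicPerm T-periodic
  Ti≡T0+i : ∀ {i} → i < suc t → T i ≡ T 0 + i
  Ti≡T0+i {zero}  _     = sym (+-identityʳ (T 0))
  Ti≡T0+i {suc i} 1+i<t = begin
    T (suc i)        ≡⟨ step-up 1+i<t (<-≤-trans (bounded (<-trans (n<1+n i) 1+i<t)) t≤h) ⟩
    T i + 1          ≡⟨ cong (_+ 1) (Ti≡T0+i (<-trans (n<1+n i) 1+i<t)) ⟩
    T 0 + i + 1      ≡⟨ +-assoc (T 0) i 1 ⟩
    T 0 + (i + 1)    ≡⟨ cong (T 0 +_) (+-comm i 1) ⟩
    T 0 + suc i      ∎

module _ {h k t T} (T-periodic : IsPeriodicPerm h k t T) where
  open IsPeriodicPerm T-periodic

  dead-end⇒last : ∀ {j} → j < t → T j < h → t ≤ T j + k → suc j ≡ t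
  dead-end⇒last {j} j<t Tj<h t≤Tj+k with suc j <? t
  ... | yes 1+j<t = contradiction (subst (_< t) (step-up 1+j<t Tj<h) (bounded 1+j<t)) (≤⇒≯ t≤Tj+k)
  ... | no 1+j≮t  = ≤-antisym j<t (≮⇒≥ 1+j≮t)

  two-dead-ends : ∀ {x} → suc x < t → suc x < h → t ≤ x + k → ⊥
  two-dead-ends {x} 1+x<t 1+x<h t≤x+k with i , i<t , Ti≡x ← surjective (<-trans (n<1+n x) 1+x<t)
                                    | j , j<t , Tj≡1+x ← surjective 1+x<t =
    contradiction (trans (sym Ti≡x) (trans (cong T (suc-injective (trans last-i (sym last-j)))) Tj≡1+x))
        (m≢1+n+m x {0})
    where
    last-i : suc i ≡ t
    last-i = dead-end⇒last i<t (subst (_< h) (sym Ti≡x) (<-trans (n<1+n x) 1+x<h))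
        (subst (λ y → t ≤ y + k) (sym Ti≡x) t≤x+k)
    last-j : suc j ≡ t
    last-j = dead-end⇒last j<t (subst (_< h) (sym Tj≡1+x) 1+x<h)
        (subst (λ y → t ≤ y + k) (sym Tj≡1+x) (≤-trans t≤x+k (n≤1+n _)))

-- h and k are taken as successors, so that N is visibly nonzero as a divisor.
module Cyclic (h′ k′ : ℕ) where

  h k N : ℕ
  h = suc h′
  k = suc k′
  N = h + k

  k<N : k < N
  k<N = m<n+m k {h} z<s

  -- A h k (suc c) is permMat (blockSeq c) by definition.
  blockSeq : ℕ → ℕ → ℕ
  blockSeq c i = (k * i + c) % N

  blockSeq<N : ∀ c i → blockSeq c i < N
  blockSeq<N c i = m%n<n (k * i + c) N

  blockSeq-zero : ∀ {c} → c < N → blockSeq c 0 ≡ c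
  blockSeq-zero {c} c<N = trans (cong (λ x → (x + c) % N) (*-zeroʳ k)) (m<n⇒m%n≡m c<N)

  blockSeq-one : blockSeq 0 1 ≡ k
  blockSeq-one = trans (cong (λ x → (x + 0) % N) (*-identityʳ k))
      (trans (cong (_% N) (+-identityʳ k)) (m<n⇒m%n≡m k<N))

  [x%N+k]%N≡[x+k]%N : ∀ x → (x % N + k) % N ≡ (x + k) % N
  [x%N+k]%N≡[x+k]%N x = begin
    (x % N + k) % N            ≡⟨ %-distribˡ-+ (x % N) k N ⟩
    (x % N % N + k % N) % N    ≡⟨ cong (λ y → (y + k % N) % N) (m%n%n≡m%n x N) ⟩
    (x % N + k % N) % N        ≡⟨ %-distribˡ-+ x k N ⟨
    (x + k) % N                ∎

  blockSeq-suc : ∀ c i → blockSeq c (suc i) ≡ (blockSeq c i + k) % N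
  blockSeq-suc c i = trans (cong (_% N) (shift k i c)) (sym ([x%N+k]%N≡[x+k]%N (k * i + c)))
    where
    shift : ∀ k i c → k * suc i + c ≡ k * i + c + k
    shift = solve-∀

  Step-+k%N : ∀ {x} → x < N → Step h k x ((x + k) % N)
  Step-+k%N {x} x<N with <2n⇒%-cases {N} {x + k} (+-mono-< x<N k<N)
  ... | inj₁ x+k≡y   = inj₂ (sym x+k≡y)
  ... | inj₂ x+k≡N+y = inj₁ (+-cancelʳ-≡ k _ _ (begin
    y + h + k  ≡⟨ +-assoc y h k ⟩
    y + N      ≡⟨ +-comm y N ⟩
    N + y      ≡⟨ x+k≡N+y ⟨
    x + k      ∎))
    where
    y : ℕ
    y = (x + k) % N

  Step⇒≡+k%N : ∀ {u u′} → u′ < N → Step h k u u′ → u′ ≡ (u + k) % N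
  Step⇒≡+k%N {u} {u′} u′<N (inj₁ u′+h≡u) = sym (begin
    (u + k) % N         ≡⟨ cong (λ x → (x + k) % N) u′+h≡u ⟨
    (u′ + h + k) % N    ≡⟨ cong (_% N) (+-assoc u′ h k) ⟩
    (u′ + N) % N        ≡⟨ [m+n]%n≡m%n u′ N ⟩
    u′ % N              ≡⟨ m<n⇒m%n≡m u′<N ⟩
    u′                  ∎)
  Step⇒≡+k%N u′<N (inj₂ u′≡u+k) = trans (sym (m<n⇒m%n≡m u′<N)) (cong (_% N) u′≡u+k)

  steps⇒blockSeq : ∀ {n u} → Bounded n N u → (∀ {i} → suc i < n → Step h k (u i) (u (suc i))) →
                   u ≗[ n ] blockSeq (u 0)
  steps⇒blockSeq u-bounded u-step {zero}  0<n   = sym (blockSeq-zero (u-bounded 0<n))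
  steps⇒blockSeq {u = u} u-bounded u-step {suc i} 1+i<n = begin
    u (suc i)                   ≡⟨ Step⇒≡+k%N (u-bounded 1+i<n) (u-step 1+i<n) ⟩
    (u i + k) % N               ≡⟨ cong (λ x → (x + k) % N)
        (steps⇒blockSeq u-bounded u-step (<-trans (n<1+n i) 1+i<n)) ⟩
    (blockSeq (u 0) i + k) % N  ≡⟨ blockSeq-suc (u 0) i ⟨
    blockSeq (u 0) (suc i)      ∎

  %≡%⇒∣ : ∀ x y → x % N ≡ (x + y) % N → N ∣ y
  %≡%⇒∣ x y x%N≡[x+y]%N = ∣m+n∣m⇒∣n (divides q₂ (+-cancelˡ-≡ (x % N) _ _ (begin
    x % N + (q₁ * N + y)   ≡⟨ +-assoc (x % N) (q₁ * N) y ⟨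
    x % N + q₁ * N + y     ≡⟨ cong (_+ y) (m≡m%n+[m/n]*n x N) ⟨
    x + y                  ≡⟨ m≡m%n+[m/n]*n (x + y) N ⟩
    (x + y) % N + q₂ * N   ≡⟨ cong (_+ q₂ * N) x%N≡[x+y]%N ⟨
    x % N + q₂ * N         ∎))) (n∣m*n q₁)
    where
    q₁ q₂ : ℕ
    q₁ = x / N
    q₂ = (x + y) / N

  module _ (coprime : Coprime N k) (c : ℕ) where

    blockSeq-≢ : ∀ {i j} → i < j → j < N → blockSeq c i ≢ blockSeq c j
    blockSeq-≢ {i} i<j j<N eq with m≤n⇒∃[o]m+o≡n i<j
    ... | o , refl = <⇒≱ j<N (≤-trans N≤1+o (s≤s (m≤n+m o i)))
      where
      split : ∀ k i o c → k * (suc i + o) + c ≡ (k * i + c) + k * suc o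
      split = solve-∀
      N≤1+o : N ≤ suc o
      N≤1+o = ∣⇒≤ (coprime-divisor coprime (%≡%⇒∣ (k * i + c) (k * suc o)
                (trans eq (cong (_% N) (split k i o c)))))

    blockSeq-injective : InjectiveBelow N (blockSeq c)
    blockSeq-injective {i} {j} i<N j<N eq with <-cmp i j
    ... | tri< i<j _ _ = contradiction eq (blockSeq-≢ i<j j<N)
    ... | tri≈ _ i≡j _ = i≡j
    ... | tri> _ _ j<i = contradiction (sym eq) (blockSeq-≢ j<i i<N)

    blockSeq-periodic : IsPeriodicPerm h k N (blockSeq c)
    blockSeq-periodic = record
      { bounded   = λ {i} _ → blockSeq<N c i
      ; injective = blockSeq-injective
      ; step      = λ {i} _ → subst (Step h k _) (sym (blockSeq-suc c i)) (Step-+k%N (blockSeq<N c i))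
      }

  blockSeq-last+k%N : ∀ {c} → c < N → (blockSeq c (N ∸ 1) + k) % N ≡ c
  blockSeq-last+k%N {c} c<N = begin
    (blockSeq c (N ∸ 1) + k) % N  ≡⟨ [x%N+k]%N≡[x+k]%N (k * (N ∸ 1) + c) ⟩
    (k * (N ∸ 1) + c + k) % N     ≡⟨ cong (_% N) (wrap k (N ∸ 1) c) ⟩
    (c + k * N) % N               ≡⟨ [m+kn]%n≡m%n c k N ⟩
    c % N                         ≡⟨ m<n⇒m%n≡m c<N ⟩
    c                             ∎
    where
    wrap : ∀ k n c → k * n + c + k ≡ c + k * suc n
    wrap = solve-∀

  -- The block with offset c ends at c − k (mod N).
  blockSeq-last+k : ∀ {c} → c < N → blockSeq c (N ∸ 1) + k ≡ c ⊎ blockSeq c (N ∸ 1) + k ≡ N + c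
  blockSeq-last+k {c} c<N with <2n⇒%-cases {N} {blockSeq c (N ∸ 1) + k} (+-mono-< (blockSeq<N c (N ∸ 1)) k<N)
  ... | inj₁ eq = inj₁ (trans eq (blockSeq-last+k%N c<N))
  ... | inj₂ eq = inj₂ (trans eq (cong (N +_) (blockSeq-last+k%N c<N)))

  module _ {c : ℕ} where

    private
      y : ℕ
      y = blockSeq c (N ∸ 1)

      y<N : y < N
      y<N = blockSeq<N c (N ∸ 1)

      N+c≡y+k⇒c<k : y + k ≡ N + c → c < k
      N+c≡y+k⇒c<k y+k≡N+c = +-cancelˡ-< N c k (subst (_< N + k) y+k≡N+c (+-monoˡ-< k y<N))

    lower-junction : ∀ {x} → c < N → Step h k y (N + x) → x ≡ c × c < k
    lower-junction {x} c<N (inj₁ N+x+h≡y) = contradiction (subst (_< N) (sym N+x+h≡y) y<N)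
        (subst (_≮ N) (sym (+-assoc N x h)) (m+n≮m N (x + h)))
    lower-junction {x} c<N (inj₂ N+x≡y+k) with blockSeq-last+k c<N
    ... | inj₁ y+k≡c   = contradiction (subst (_< N) (sym (trans N+x≡y+k y+k≡c)) c<N) (m+n≮m N x)
    ... | inj₂ y+k≡N+c = +-cancelˡ-≡ N x c (trans N+x≡y+k y+k≡N+c) , N+c≡y+k⇒c<k y+k≡N+c

    upper-junction : ∀ {e x} → c < N → x < e → Step h k (e + y) x → x + N ≡ e + c × k ≤ c
    upper-junction {e} {x} c<N x<e (inj₂ x≡e+y+k) = contradiction (subst (_< e) x≡e+y+k x<e)
        (subst (_≮ e) (sym (+-assoc e y k)) (m+n≮m e (y + k)))
    upper-junction {e} {x} c<N x<e (inj₁ x+h≡e+y) with blockSeq-last+k c<N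
    ... | inj₂ y+k≡N+c = contradiction (subst (_< N) y+k≡N+c (+-monoˡ-< k y<h)) (m+n≮m N c)
      where
      y<h : y < h
      y<h = +-cancelˡ-< e y h (subst (_< e + h) x+h≡e+y (+-monoˡ-< h x<e))
    ... | inj₁ y+k≡c = (begin
      x + N        ≡⟨ +-assoc x h k ⟨
      x + h + k    ≡⟨ cong (_+ k) x+h≡e+y ⟩
      e + y + k    ≡⟨ +-assoc e y k ⟩
      e + (y + k)  ≡⟨ cong (e +_) y+k≡c ⟩
      e + c        ∎) , subst (k ≤_) y+k≡c (m≤n+m k y)

    lower-junction-step : c < k → Step h k y (N + c)
    lower-junction-step c<k with blockSeq-last+k (<-trans c<k k<N)
    ... | inj₁ y+k≡c   = contradiction (subst (k ≤_) y+k≡c (m≤n+m k y)) (<⇒≱ c<k)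
    ... | inj₂ y+k≡N+c = inj₂ (sym y+k≡N+c)

    upper-junction-step : ∀ {e x} → k ≤ c → c < N → x + N ≡ e + c → Step h k (e + y) x
    upper-junction-step {e} {x} k≤c c<N x+N≡e+c with blockSeq-last+k c<N
    ... | inj₂ y+k≡N+c = contradiction (N+c≡y+k⇒c<k y+k≡N+c) (≤⇒≯ k≤c)
    ... | inj₁ y+k≡c   = inj₁ (+-cancelʳ-≡ k _ _ (begin
      x + h + k    ≡⟨ +-assoc x h k ⟩
      x + N        ≡⟨ x+N≡e+c ⟩
      e + c        ≡⟨ cong (e +_) y+k≡c ⟨
      e + (y + k)  ≡⟨ +-assoc e y k ⟨
      e + y + k    ∎))

  window⇒blockSeq : ∀ {n a σ} → (∀ {i} → suc i < n → Step h k (σ i) (σ (suc i))) → Within n a N σ →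
                    ∀ {i} → i < n → σ i ≡ a + blockSeq (σ 0 ∸ a) i
  window⇒blockSeq {n} {a} {σ} σ-step σ-within {i} i<n = begin
    σ i                        ≡⟨ m+[n∸m]≡n (proj₁ (σ-within i<n)) ⟨
    a + (σ i ∸ a)              ≡⟨ cong (a +_) (steps⇒blockSeq u-bounded u-step i<n) ⟩
    a + blockSeq (σ 0 ∸ a) i   ∎
    where
    u : ℕ → ℕ
    u i = σ i ∸ a
    u-bounded : Bounded n N u
    u-bounded i<n = x<a+w⇒x∸a<w (proj₁ (σ-within i<n)) (proj₂ (σ-within i<n))
    u-step : ∀ {i} → suc i < n → Step h k (u i) (u (suc i))
    u-step {i} 1+i<n = Step-∸ a (proj₁ (σ-within (<-trans (n<1+n i) 1+i<n))) (proj₁ (σ-within 1+i<n)) (σ-step 1+i<n)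

  -- Peeling off the first block

  Peeled : ℕ → ℕ → ℕ → (ℕ → ℕ) → Set
  Peeled d a b σ = ∃ λ c → c < N × ∃ λ g → IsPeriodicPerm h k d g × σ ≗[ N + d ] glue N a b (blockSeq c) g

  module _ {d : ℕ} {σ : ℕ → ℕ} (σ-periodic : IsPeriodicPerm h k (N + d) σ) where
    open IsPeriodicPerm σ-periodic

    private
      last : ℕ
      last = N ∸ 1 + d

      not-last : ∀ {j} → j < N + d → j ≢ last → suc j < N + d
      not-last j<N+d j≢last = s≤s (≤∧≢⇒< (s≤s⁻¹ j<N+d) j≢last)

    windows⇒peeled : ∀ {a b} → Within N a N σ → Within d b d (λ j → σ (N + j)) → Peeled d a b σ
    windows⇒peeled {a} {b} first-within rest-within =
      σ 0 ∸ a , x<a+w⇒x∸a<w (proj₁ (first-within 0<N)) (proj₂ (first-within 0<N)) ,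
      g , suffix-periodic σ-periodic rest-within ,
      ≗-glue (window⇒blockSeq (λ 1+i<N → step (<-≤-trans 1+i<N (m≤m+n N d))) first-within)
             (λ j<d → sym (m+[n∸m]≡n (proj₁ (rest-within j<d))))
      where
      0<N : 0 < N
      0<N = z<s
      g : ℕ → ℕ
      g j = σ (N + j) ∸ b

    -- A drop from σ i ≥ N to z < N is impossible: the value z ∸ k < h is not the last entry
    -- (σ ends at a value ≥ h), so it is followed by z and would sit at position i.
    high-persists : h ≤ σ last → ∀ {i} → suc i < N + d → N ≤ σ i → N ≤ σ (suc i)
    high-persists h≤σlast {i} 1+i<N+d N≤σi with N ≤? σ (suc i)
    ... | yes N≤σ1+i = N≤σ1+i
    ... | no N≰σ1+i with step 1+i<N+d
    ...   | inj₂ σ1+i≡σi+k = contradiction (subst (N ≤_) (sym σ1+i≡σi+k) (≤-trans N≤σi (m≤m+n (σ i) k))) N≰σ1+i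
    ...   | inj₁ σ1+i+h≡σi = contradiction (surjective x<N+d) no-preimage
      where
      z : ℕ
      z = σ (suc i)
      k≤z : k ≤ z
      k≤z = +-cancelʳ-≤ h k z (subst (_≤ z + h) (+-comm h k) (subst (N ≤_) (sym σ1+i+h≡σi) N≤σi))
      x : ℕ
      x = z ∸ k
      x+k≡z : x + k ≡ z
      x+k≡z = m∸n+n≡m k≤z
      x<h : x < h
      x<h = +-cancelʳ-< k x h (subst (_< N) (sym x+k≡z) (≰⇒> N≰σ1+i))
      x<N+d : x < N + d
      x<N+d = <-≤-trans x<h (≤-trans (m≤m+n h k) (m≤m+n N d))
      no-preimage : ¬ (∃ λ j → j < N + d × σ j ≡ x)
      no-preimage (j , j<N+d , σj≡x) with j ≟ last
      ... | yes refl  = <⇒≱ x<h (subst (h ≤_) σj≡x h≤σlast)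
      ... | no j≢last = <⇒≱ (<-≤-trans σi<h (m≤m+n h k)) N≤σi
        where
        σj<h : σ j < h
        σj<h = subst (_< h) (sym σj≡x) x<h
        j≡i : j ≡ i
        j≡i = suc-injective (injective (not-last j<N+d j≢last) 1+i<N+d
                (trans (step-up (not-last j<N+d j≢last) σj<h) (trans (cong (_+ k) σj≡x) x+k≡z)))
        σi<h : σ i < h
        σi<h = subst (λ m → σ m < h) j≡i σj<h

    -- A climb from σ i < d to σ (1 + i) ≥ d is impossible: the value σ i + N ≥ h is not the
    -- last entry, so it is followed by σ (1 + i) and would sit at position i.
    low-persists : σ last < h → ∀ {i} → suc i < N + d → σ i < d → σ (suc i) < d
    low-persists σlast<h {i} 1+i<N+d σi<d with σ (suc i) <? d
    ... | yes σ1+i<d = σ1+i<d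
    ... | no σ1+i≮d with step 1+i<N+d
    ...   | inj₁ σ1+i+h≡σi = contradiction (≤-<-trans (subst (σ (suc i) ≤_) σ1+i+h≡σi (m≤m+n _ h)) σi<d) σ1+i≮d
    ...   | inj₂ σ1+i≡σi+k = contradiction (surjective y<N+d) no-preimage
      where
      y : ℕ
      y = σ i + N
      y<N+d : y < N + d
      y<N+d = subst (y <_) (+-comm d N) (+-monoˡ-< N σi<d)
      no-preimage : ¬ (∃ λ j → j < N + d × σ j ≡ y)
      no-preimage (j , j<N+d , σj≡y) with j ≟ last
      ... | yes refl  = <⇒≱ σlast<h (subst (h ≤_) (sym σj≡y) (≤-trans (m≤m+n h k) (m≤n+m N (σ i))))
      ... | no j≢last = contradiction
          (+-cancelˡ-≡ (σ i) N 0 (trans (sym σj≡y) (trans (cong σ j≡i) (sym (+-identityʳ (σ i)))))) λ ()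
        where
        N+d≤σj+k : N + d ≤ σ j + k
        N+d≤σj+k = ≤-trans (+-monoʳ-≤ N (≮⇒≥ σ1+i≮d)) (≤-reflexive (begin
          N + σ (suc i)    ≡⟨ cong (N +_) σ1+i≡σi+k ⟩
          N + (σ i + k)    ≡⟨ +-assoc N (σ i) k ⟨
          N + σ i + k      ≡⟨ cong (_+ k) (trans (+-comm N (σ i)) (sym σj≡y)) ⟩
          σ j + k          ∎))
        j≡i : j ≡ i
        j≡i = suc-injective (injective (not-last j<N+d j≢last) 1+i<N+d (+-cancelʳ-≡ h _ _ (begin
          σ (suc j) + h      ≡⟨ step-down (not-last j<N+d j≢last) N+d≤σj+k ⟩
          σ j                ≡⟨ σj≡y ⟩
          σ i + (h + k)      ≡⟨ cong (σ i +_) (+-comm h k) ⟩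
          σ i + (k + h)      ≡⟨ +-assoc (σ i) k h ⟨
          σ i + k + h        ≡⟨ cong (_+ h) σ1+i≡σi+k ⟨
          σ (suc i) + h      ∎)))

    lower-first : h ≤ σ last → Within N 0 N σ
    lower-first h≤σlast i<N = z≤n , ≰⇒> (persistent⇒avoidsPrefix {P = N ≤_} surjective (high-persists h≤σlast)
      (λ v<N → <-≤-trans v<N (m≤m+n N d)) (λ _ _ v≡w → v≡w) <⇒≱ i<N)

    lower-rest : h ≤ σ last → Within d N d (λ j → σ (N + j))
    lower-rest h≤σlast {j} j<d = ≮⇒≥
        (window-exhausted injective (m≤m+n N d) (lower-first h≤σlast) (m≤m+n N j) (+-monoʳ-< N j<d) z≤n) ,
                                 bounded (+-monoʳ-< N j<d)

    upper-first : σ last < h → Within N d N σ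
    upper-first σlast<h {i} i<N =
      ≮⇒≥ (persistent⇒avoidsPrefix {P = _< d} surjective (low-persists σlast<h)
             (λ {v} v<N → subst (d + v <_) (+-comm d N) (+-monoʳ-< d v<N)) (λ _ _ → +-cancelˡ-≡ d _ _)
                 (λ {v} _ → m+n≮m d v) i<N) ,
      subst (σ i <_) (+-comm N d) (bounded (<-≤-trans i<N (m≤m+n N d)))

    upper-rest : σ last < h → Within d 0 d (λ j → σ (N + j))
    upper-rest σlast<h {j} j<d = z≤n , ≰⇒> λ d≤σN+j → window-exhausted injective (m≤m+n N d) (upper-first σlast<h)
        (m≤m+n N j) N+j<N+d d≤σN+j
                                                      (subst (σ (N + j) <_) (+-comm N d) (bounded N+j<N+d))
      where
      N+j<N+d : N + j < N + d
      N+j<N+d = +-monoʳ-< N j<d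

    peel : Peeled d 0 N σ ⊎ Peeled d d 0 σ
    peel with h ≤? σ last
    ... | yes h≤σlast = inj₁ (windows⇒peeled (lower-first h≤σlast) (lower-rest h≤σlast))
    ... | no h≰σlast  = inj₂ (windows⇒peeled (upper-first (≰⇒> h≰σlast)) (upper-rest (≰⇒> h≰σlast)))

  -- Classification of walks by their blocks

  -- The permutations of diag (A_{c+1}, …, A_{c+1}, T) and of antidiag (B, …, B; T) with ℓ
  -- blocks of offset c; T has size t.
  diagSeq : ℕ → ℕ → (ℕ → ℕ) → ℕ → ℕ
  diagSeq zero    c T = T
  diagSeq (suc ℓ) c T = glue N 0 N (blockSeq c) (diagSeq ℓ c T)

  antidiagSeq : ℕ → ℕ → ℕ → (ℕ → ℕ) → ℕ → ℕ
  antidiagSeq zero    c t T = T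
  antidiagSeq (suc ℓ) c t T = glue N (ℓ * N + t) 0 (blockSeq c) (antidiagSeq ℓ c t T)

  diagSeq-zero : ∀ ℓ {c T} → c < N → diagSeq (suc ℓ) c T 0 ≡ c
  diagSeq-zero ℓ c<N = trans (glue-< z<s) (blockSeq-zero c<N)

  antidiagSeq-zero : ∀ ℓ {c t T} → c < N → antidiagSeq (suc ℓ) c t T 0 ≡ ℓ * N + t + c
  antidiagSeq-zero ℓ {c} {t} c<N = trans (glue-< z<s) (cong (ℓ * N + t +_) (blockSeq-zero c<N))

  record DiagForm (ℓ t : ℕ) (σ : ℕ → ℕ) : Set where
    constructor diagForm
    field
      offset        : ℕ
      offset<k      : offset < k
      tail          : ℕ → ℕ
      tail-periodic : IsPeriodicPerm h k t tail
      agrees        : σ ≗[ ℓ * N + t ] diagSeq ℓ offset tail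
      junction      : 0 < ℓ → 0 < t → tail 0 ≡ offset

  record AntidiagForm (ℓ t : ℕ) (σ : ℕ → ℕ) : Set where
    constructor antidiagForm
    field
      offset        : ℕ
      k≤offset      : k ≤ offset
      offset<N      : offset < N
      tail          : ℕ → ℕ
      tail-periodic : IsPeriodicPerm h k t tail
      agrees        : σ ≗[ ℓ * N + t ] antidiagSeq ℓ offset t tail
      junction      : 0 < ℓ → 0 < t → tail 0 + N ≡ t + offset

  Form : ℕ → ℕ → (ℕ → ℕ) → Set
  Form ℓ t σ = DiagForm ℓ t σ ⊎ AntidiagForm ℓ t σ

  ≗-assoc : ∀ {ℓ t σ τ} → σ ≗[ N + (ℓ * N + t) ] τ → σ ≗[ suc ℓ * N + t ] τ
  ≗-assoc {ℓ} {t} σ≗τ {i} i<n = σ≗τ (subst (i <_) (+-assoc N (ℓ * N) t) i<n)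

  single-block : ∀ {σ c b g} → c < N → σ ≗[ N + 0 ] glue N 0 b (blockSeq c) g → Form 1 0 σ
  single-block {σ} {c} {b} {g} c<N σ≗ with c <? k
  ... | yes c<k = inj₁ (diagForm c c<k g empty-periodic (≗-assoc {0} (≗-glue-cong σ≗ (λ _ → refl) λ ())) λ _ ())
  ... | no c≮k  = inj₂
      (antidiagForm c (≮⇒≥ c≮k) c<N g empty-periodic (≗-assoc {0} (≗-glue-cong σ≗ (λ _ → refl) λ ())) λ _ ())

  module _ {t c : ℕ} {σ g : ℕ → ℕ} (c<N : c < N) where

    lower-extend : ∀ ℓ → IsPeriodicPerm h k (ℓ * N + t) g → σ ≗[ N + (ℓ * N + t) ] glue N 0 N (blockSeq c) g →
                   0 < ℓ * N + t → g 0 ≡ c → c < k → Form ℓ t g → DiagForm (suc ℓ) t σ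
    lower-extend zero g-periodic σ≗ _ g0≡c c<k _ =
      diagForm c c<k g g-periodic (≗-assoc {0} σ≗) (λ _ _ → g0≡c)
    lower-extend (suc ℓ) _ σ≗ 0<d g0≡c c<k (inj₁ (diagForm c′ c′<k T T-periodic g≗ T-junction)) =
      diagForm c c<k T T-periodic
        (≗-assoc {suc ℓ} (≗-glue-cong σ≗ (λ _ → refl) λ {j} j<d → cong (N +_)
            (trans (g≗ j<d) (cong (λ x → diagSeq (suc ℓ) x T j) c′≡c))))
        (λ _ 0<t → trans (T-junction z<s 0<t) c′≡c)
      where
      c′≡c : c′ ≡ c
      c′≡c = trans (sym (diagSeq-zero ℓ (<-trans c′<k k<N))) (trans (sym (g≗ 0<d)) g0≡c)
    lower-extend (suc ℓ) _ _ 0<d g0≡c c<k (inj₂ (antidiagForm c′ k≤c′ c′<N T _ g≗ _)) =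
      contradiction c<k (≤⇒≯ (≤-trans k≤c′ (≤-trans (m≤n+m c′ _) (≤-reflexive (begin
        ℓ * N + t + c′                ≡⟨ antidiagSeq-zero ℓ c′<N ⟨
        antidiagSeq (suc ℓ) c′ t T 0  ≡⟨ g≗ 0<d ⟨
        g 0                           ≡⟨ g0≡c ⟩
        c                             ∎)))))

    upper-extend : ∀ ℓ → IsPeriodicPerm h k (ℓ * N + t) g →
                   σ ≗[ N + (ℓ * N + t) ] glue N (ℓ * N + t) 0 (blockSeq c) g →
                   0 < ℓ * N + t → g 0 + N ≡ ℓ * N + t + c → k ≤ c → Form ℓ t g → AntidiagForm (suc ℓ) t σ
    upper-extend zero g-periodic σ≗ _ g0+N≡t+c k≤c _ =
      antidiagForm c k≤c c<N g g-periodic (≗-assoc {0} σ≗) (λ _ _ → g0+N≡t+c)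
    upper-extend (suc ℓ) _ σ≗ 0<d g0+N≡d+c k≤c (inj₂ (antidiagForm c′ _ c′<N T T-periodic g≗ T-junction)) =
      antidiagForm c k≤c c<N T T-periodic
        (≗-assoc {suc ℓ} (≗-glue-cong σ≗ (λ _ → refl) λ {j} j<d → trans (g≗ j<d)
            (cong (λ x → antidiagSeq (suc ℓ) x t T j) c′≡c)))
        (λ _ 0<t → trans (T-junction z<s 0<t) (cong (t +_) c′≡c))
      where
      regroup : ∀ a b c N → a + b + c + N ≡ N + a + b + c
      regroup = solve-∀
      c′≡c : c′ ≡ c
      c′≡c = +-cancelˡ-≡ (suc ℓ * N + t) c′ c (begin
        N + ℓ * N + t + c′                 ≡⟨ regroup (ℓ * N) t c′ N ⟨
        ℓ * N + t + c′ + N                 ≡⟨ cong (_+ N) (antidiagSeq-zero ℓ c′<N) ⟨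
        antidiagSeq (suc ℓ) c′ t T 0 + N   ≡⟨ cong (_+ N) (g≗ 0<d) ⟨
        g 0 + N                            ≡⟨ g0+N≡d+c ⟩
        N + ℓ * N + t + c                  ∎)
    upper-extend (suc ℓ) _ _ 0<d g0+N≡d+c k≤c (inj₁ (diagForm c′ c′<k T _ g≗ _)) =
      contradiction g0+N≡d+c (<⇒≢ (subst (_< suc ℓ * N + t + c) (cong (_+ N) c′≡g0) c′+N<d+c))
      where
      c′≡g0 : c′ ≡ g 0
      c′≡g0 = sym (trans (g≗ 0<d) (diagSeq-zero ℓ (<-trans c′<k k<N)))
      c′+N<d+c : c′ + N < suc ℓ * N + t + c
      c′+N<d+c = <-≤-trans (+-monoˡ-< N (<-≤-trans c′<k k≤c))
                   (≤-trans (≤-reflexive (+-comm c N)) (+-monoˡ-≤ c (≤-trans (m≤m+n N (ℓ * N)) (m≤m+n _ t))))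

  extend : ∀ ℓ {t σ} → IsPeriodicPerm h k (N + (ℓ * N + t)) σ → 0 < ℓ * N + t →
           (∀ {g} → IsPeriodicPerm h k (ℓ * N + t) g → Form ℓ t g) → Form (suc ℓ) t σ
  extend ℓ σ-periodic 0<d classify-rest with peel σ-periodic
  ... | inj₁ (c , c<N , g , g-periodic , σ≗) =
    let g0≡c , c<k = lower-junction c<N (glue-junction σ-periodic σ≗ 0<d)
    in inj₁ (lower-extend c<N ℓ g-periodic σ≗ 0<d g0≡c c<k (classify-rest g-periodic))
  ... | inj₂ (c , c<N , g , g-periodic , σ≗) =
    let g0+N≡d+c , k≤c = upper-junction c<N (IsPeriodicPerm.bounded g-periodic 0<d) (glue-junction σ-periodic σ≗ 0<d)
    in inj₂ (upper-extend c<N ℓ g-periodic σ≗ 0<d g0+N≡d+c k≤c (classify-rest g-periodic))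

  periodic-assoc : ∀ ℓ {t σ} → IsPeriodicPerm h k (suc ℓ * N + t) σ → IsPeriodicPerm h k (N + (ℓ * N + t)) σ
  periodic-assoc ℓ {t} {σ} = subst (λ D → IsPeriodicPerm h k D σ) (+-assoc N (ℓ * N) t)

  classify : ∀ ℓ {t σ} → IsPeriodicPerm h k (ℓ * N + t) σ → Form ℓ t σ
  classify zero {σ = σ} σ-periodic = inj₁ (diagForm 0 z<s σ σ-periodic (λ _ → refl) λ ())
  classify (suc zero) {zero} σ-periodic with peel (periodic-assoc 0 σ-periodic)
  ... | inj₁ (c , c<N , _ , _ , σ≗) = single-block c<N σ≗
  ... | inj₂ (c , c<N , _ , _ , σ≗) = single-block c<N σ≗
  classify (suc zero) {suc t} σ-periodic = extend 0 (periodic-assoc 0 σ-periodic) z<s (classify 0)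
  classify (suc (suc ℓ)) σ-periodic = extend (suc ℓ) (periodic-assoc (suc ℓ) σ-periodic) z<s (classify (suc ℓ))

  by-form : (R : (d : ℕ) → (Fin d → Fin d → ℕ) → Set) →
            (∀ ℓ t {σ} {M : Fin (ℓ * N + t) → Fin (ℓ * N + t) → ℕ} →
               t < N → 0 < ℓ * N + t → M ≈M permMat σ → Form ℓ t σ → R (ℓ * N + t) M) →
            ∀ {d M} → 0 < d → IsPPM h k d M → R d M
  by-form R on-form {d} 0<d M-ppm = go (d / N) (d % N) (m%n<n d N)
      (trans (m≡m%n+[m/n]*n d N) (+-comm (d % N) _)) 0<d M-ppm
    where
    go : ∀ {d} ℓ t {M} → t < N → d ≡ ℓ * N + t → 0 < d → IsPPM h k d M → R d M
    go ℓ t t<N refl 0<d M-ppm with σ , σ-periodic , M≈σ ← IsPPM⇒periodicPerm M-ppm =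
      on-form ℓ t t<N 0<d M≈σ (classify ℓ σ-periodic)

  -- B h k m is permMat (blockSeq (bOffset m)) by definition.
  bOffset : ℕ → ℕ
  bOffset m = h + k + 1 ∸ m ∸ 1

  bOffset-∸ : ∀ {m} → 1 ≤ m → bOffset m ≡ N ∸ m
  bOffset-∸ {suc m} _ = begin
    h + k + 1 ∸ suc m ∸ 1  ≡⟨ cong (λ x → x ∸ suc m ∸ 1) (+-comm N 1) ⟩
    N ∸ m ∸ 1              ≡⟨ ∸-+-assoc N m 1 ⟩
    N ∸ (m + 1)            ≡⟨ cong (N ∸_) (+-comm m 1) ⟩
    N ∸ suc m              ∎

  bOffset-1 : bOffset 1 ≡ N ∸ 1
  bOffset-1 = bOffset-∸ ≤-refl

  bOffset-h : bOffset h ≡ k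
  bOffset-h = trans (bOffset-∸ {h} (s≤s z≤n)) (m+n∸m≡n h k)

  diag-copies : ∀ ℓ {c rest T} → diag rest ≈[ size rest ] permMat T →
                diag (copies ℓ (N , A h k (suc c)) ++ rest) ≈[ ℓ * N + size rest ] permMat (diagSeq ℓ c T)
  diag-copies zero    rest≈T = rest≈T
  diag-copies (suc ℓ) {c} {rest} rest≈T =
    ≈-resize (size-copies (suc ℓ) rest)
      (diag-glue {X = A h k (suc c)} (λ _ _ → refl) (λ {i} _ → blockSeq<N c i)
        {bs = copies ℓ (N , A h k (suc c)) ++ rest}
        (≈-resize (sym (size-copies ℓ rest)) (diag-copies ℓ {c} {rest} rest≈T)))

  antidiagSeq-bounded : ∀ ℓ {c t T} → Bounded t t T → Bounded (ℓ * N + t) (ℓ * N + t) (antidiagSeq ℓ c t T)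
  antidiagSeq-bounded zero    T-bounded = T-bounded
  antidiagSeq-bounded (suc ℓ) {c} {t} {T} T-bounded =
    subst (λ D → Bounded D D (antidiagSeq (suc ℓ) c t T)) (sym (+-assoc N (ℓ * N) t))
      (glue-bounded (λ {i} _ → blockSeq<N c i) (antidiagSeq-bounded ℓ T-bounded)
          (≤-reflexive (+-comm (ℓ * N + t) N)) (m≤n+m _ N))

  antidiag-copies : ∀ ℓ {m rest T} → antidiag rest ≈[ size rest ] permMat T → Bounded (size rest) (size rest) T →
                    antidiag (copies ℓ (N , B h k m) ++ rest)
                      ≈[ ℓ * N + size rest ] permMat (antidiagSeq ℓ (bOffset m) (size rest) T)
  antidiag-copies zero    rest≈T _ = rest≈T
  antidiag-copies (suc ℓ) {m} {rest} {T} rest≈T T-bounded =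
    ≈-resize (size-copies (suc ℓ) rest)
      (subst (λ s → antidiag ((N , B h k m) ∷ bs) ≈[ N + size bs ] permMat (glue N s 0 (blockSeq (bOffset m)) g))
             (size-copies ℓ rest)
        (antidiag-glue {X = B h k m} (λ _ _ → refl) (λ {i} _ → blockSeq<N (bOffset m) i) {bs = bs}
          (≈-resize (sym (size-copies ℓ rest)) (antidiag-copies ℓ {m} {rest} rest≈T T-bounded))
          (subst (λ s → Bounded s s g) (sym (size-copies ℓ rest)) (antidiagSeq-bounded ℓ T-bounded))))
    where
    bs : List Block
    bs = copies ℓ (N , B h k m) ++ rest
    g : ℕ → ℕ
    g = antidiagSeq ℓ (bOffset m) (size rest) T

  diagSeq-offset : ∀ ℓ {c c′ T i} → (0 < ℓ → c ≡ c′) → diagSeq ℓ c T i ≡ diagSeq ℓ c′ T i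
  diagSeq-offset zero    _     = refl
  diagSeq-offset (suc ℓ) {T = T} {i} c≡c′ = cong (λ x → diagSeq (suc ℓ) x T i) (c≡c′ z<s)

  antidiagSeq-offset : ∀ ℓ {c c′ t T i} → (0 < ℓ → c ≡ c′) → antidiagSeq ℓ c t T i ≡ antidiagSeq ℓ c′ t T i
  antidiagSeq-offset zero    _     = refl
  antidiagSeq-offset (suc ℓ) {t = t} {T} {i} c≡c′ = cong (λ x → antidiagSeq (suc ℓ) x t T i) (c≡c′ z<s)

  diag-leaf : ∀ ℓ {t σ c c′ T} {M : Fin (ℓ * N + t) → Fin (ℓ * N + t) → ℕ} rest → M ≈M permMat σ →
              size rest ≡ t → diag rest ≈[ size rest ] permMat T →
              σ ≗[ ℓ * N + t ] diagSeq ℓ c T → (0 < ℓ → c ≡ c′) → M ≈M diag (copies ℓ (N , A h k (suc c′)) ++ rest)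
  diag-leaf ℓ rest M≈σ refl rest≈T σ≗ c≡c′ =
    ≈M-via M≈σ (λ i<n → trans (σ≗ i<n) (diagSeq-offset ℓ c≡c′)) (diag-copies ℓ rest≈T)

  antidiag-leaf : ∀ ℓ {t σ c m T} {M : Fin (ℓ * N + t) → Fin (ℓ * N + t) → ℕ} rest → M ≈M permMat σ →
                  size rest ≡ t → antidiag rest ≈[ size rest ] permMat T → Bounded t t T →
                  σ ≗[ ℓ * N + t ] antidiagSeq ℓ c t T → (0 < ℓ → c ≡ bOffset m) →
                  M ≈M antidiag (copies ℓ (N , B h k m) ++ rest)
  antidiag-leaf ℓ {m = m} rest M≈σ refl rest≈T T-bounded σ≗ c≡ =
    ≈M-via M≈σ (λ i<n → trans (σ≗ i<n) (antidiagSeq-offset ℓ c≡)) (antidiag-copies ℓ {m} rest≈T T-bounded)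

  1≤ℓ : ∀ {ℓ} → 0 < ℓ * N + 0 → 1 ≤ ℓ
  1≤ℓ {zero}  ()
  1≤ℓ {suc ℓ} _ = s≤s z≤n

  diag-copies-leaf : ∀ ℓ {σ c T} {M : Fin (ℓ * N + 0) → Fin (ℓ * N + 0) → ℕ} → M ≈M permMat σ →
                     σ ≗[ ℓ * N + 0 ] diagSeq ℓ c T → c < k →
                     ∃ λ m → 1 ≤ m × m ≤ k × M ≈M diag (copies ℓ (N , A h k m))
  diag-copies-leaf ℓ {c = c} {M = M} M≈σ σ≗ c<k = suc c , s≤s z≤n , c<k ,
    subst (λ bs → M ≈M diag bs) (++-identityʳ (copies ℓ (N , A h k (suc c))))
        (diag-leaf ℓ [] M≈σ refl (λ _ ()) σ≗ λ _ → refl)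

  antidiag-copies-leaf : ∀ ℓ {σ c T} {M : Fin (ℓ * N + 0) → Fin (ℓ * N + 0) → ℕ} → M ≈M permMat σ →
                         σ ≗[ ℓ * N + 0 ] antidiagSeq ℓ c 0 T → k ≤ c → c < N →
                         ∃ λ m → 1 ≤ m × m ≤ h × M ≈M antidiag (copies ℓ (N , B h k m))
  antidiag-copies-leaf ℓ {c = c} {M = M} M≈σ σ≗ k≤c c<N =
    N ∸ c , m<n⇒0<n∸m c<N , subst (N ∸ c ≤_) (m+n∸n≡m h k) (∸-monoʳ-≤ N k≤c) ,
    subst (λ bs → M ≈M antidiag bs) (++-identityʳ (copies ℓ (N , B h k (N ∸ c))))
      (antidiag-leaf ℓ {m = N ∸ c} [] M≈σ refl (λ _ ()) (λ ()) σ≗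
        λ _ → sym (trans (bOffset-∸ (m<n⇒0<n∸m c<N)) (m∸[m∸n]≡n (<⇒≤ c<N))))

  -- A walk of length N − 1 must start at k − 1, and then it is a shifted block sequence.
  module _ {T : ℕ → ℕ} (T-periodic : IsPeriodicPerm h k (N ∸ 1) T) where
    open IsPeriodicPerm T-periodic

    private
      k′+h≡N-1 : k′ + h ≡ N ∸ 1
      k′+h≡N-1 = swap h′ k′
        where
        swap : ∀ h′ k′ → k′ + suc h′ ≡ h′ + suc k′
        swap = solve-∀

      k′-at-start : ∀ {j} → j < N ∸ 1 → T j ≡ k′ → j ≡ 0
      k′-at-start {zero}  _     _     = refl
      k′-at-start {suc j} 1+j<n T1+j≡k′ with step 1+j<n
      ... | inj₁ T1+j+h≡Tj = contradiction (subst (_< N ∸ 1) Tj≡N-1 (bounded (<-trans (n<1+n j) 1+j<n))) (n≮n (N ∸ 1))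
        where
        Tj≡N-1 : T j ≡ N ∸ 1
        Tj≡N-1 = trans (sym T1+j+h≡Tj) (trans (cong (_+ h) T1+j≡k′) k′+h≡N-1)
      ... | inj₂ T1+j≡Tj+k = contradiction (subst (k ≤_) (trans (sym T1+j≡Tj+k) T1+j≡k′) (m≤n+m k (T j))) (n≮n k′)

      T0≡k′ : T 0 ≡ k′
      T0≡k′ with j , j<n , Tj≡k′ ← surjective (≤-trans (n<1+n k′) (m≤n+m k h′)) =
        subst (λ i → T i ≡ k′) (k′-at-start j<n Tj≡k′) Tj≡k′

    K-tail : ∀ {i} → i < N ∸ 1 → blockSeq 0 (suc i) ≡ suc (T i)
    K-tail {i} i<n = begin
      (k * suc i + 0) % N      ≡⟨ cong (_% N) (shift k′ i) ⟩
      suc (k * i + k′) % N     ≡⟨ suc-% (k * i + k′) (s≤s (subst (_< N ∸ 1) Ti≡ (bounded i<n))) ⟩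
      suc ((k * i + k′) % N)   ≡⟨ cong suc Ti≡ ⟨
      suc (T i)                ∎
      where
      shift : ∀ k′ i → suc k′ * suc i + 0 ≡ suc (suc k′ * i + k′)
      shift = solve-∀
      Ti≡ : T i ≡ blockSeq k′ i
      Ti≡ = trans (steps⇒blockSeq (λ j<n → <-trans (bounded j<n) (n<1+n (N ∸ 1))) step i<n)
          (cong (λ c → blockSeq c i) T0≡k′)

  K-≈ : ∀ {T} → (∀ {i} → i < N ∸ 1 → blockSeq 0 (suc i) ≡ suc (T i)) → K h k ≈[ N ∸ 1 ] permMat T
  K-≈ K≡T c r<n = cong (λ x → δ (suc c ≡ᵇ x)) (K≡T r<n)

  TailCases≥2 : ℕ → (ℕ → ℕ) → Set
  TailCases≥2 t T = t ≡ 0 ⊎ (t ≡ 1 × T 0 ≡ 0) ⊎ (t ≡ N ∸ 1 × (∀ {i} → i < N ∸ 1 → blockSeq 0 (suc i) ≡ suc (T i)))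

  -- For 2 ≤ t < N − 1 both x = t ∸ k and x + 1 are values no step can leave, so both would
  -- have to be the last entry.
  tail-cases≥2 : 2 ≤ h → 2 ≤ k → ∀ {t T} → IsPeriodicPerm h k t T → t < N → TailCases≥2 t T
  tail-cases≥2 _ _ {zero} _ _ = inj₁ refl
  tail-cases≥2 _ _ {suc zero} T-periodic _ = inj₂ (inj₁ (refl , n<1⇒n≡0 (IsPeriodicPerm.bounded T-periodic z<s)))
  tail-cases≥2 2≤h 2≤k {t@(suc (suc _))} {T} T-periodic t<N with t ≟ N ∸ 1
  ... | yes t≡N-1 = inj₂ (inj₂ (t≡N-1 , K-tail (subst (λ n → IsPeriodicPerm h k n T) t≡N-1 T-periodic)))
  ... | no t≢N-1 = ⊥-elim (two-dead-ends T-periodic 1+x<t 1+x<h (≤-trans (m≤n+m∸n t k) (≤-reflexive (+-comm k x))))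
    where
    x : ℕ
    x = t ∸ k
    2+t≤N : 2 + t ≤ N
    2+t≤N = s≤s (≤∧≢⇒< (s≤s⁻¹ t<N) t≢N-1)
    1+x<t : suc x < t
    1+x<t with k ≤? t
    ... | yes k≤t = subst (suc x <_) (m∸n+n≡m k≤t) (subst (_≤ x + k) (+-comm x 2) (+-monoʳ-≤ x 2≤k))
    ... | no k≰t  = subst (λ y → suc y < t) (sym (m≤n⇒m∸n≡0 (≰⇒≥ k≰t))) (s≤s (s≤s z≤n))
    1+x<h : suc x < h
    1+x<h with k ≤? t
    ... | yes k≤t = +-cancelʳ-≤ k (2 + x) h (subst (λ y → 2 + y ≤ N) (sym (m∸n+n≡m k≤t)) 2+t≤N)
    ... | no k≰t  = subst (λ y → suc y < h) (sym (m≤n⇒m∸n≡0 (≰⇒≥ k≰t))) 2≤h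

  module Classification (coprime : Coprime N k) where

    diagSeq-periodic : ∀ ℓ {t c T} → c < k → IsPeriodicPerm h k t T → (0 < ℓ → 0 < t → T 0 ≡ c) →
                       IsPeriodicPerm h k (ℓ * N + t) (diagSeq ℓ c T)
    diagSeq-periodic zero c<k T-periodic _ = T-periodic
    diagSeq-periodic (suc ℓ) {t} {c} {T} c<k T-periodic T-junction =
      subst (λ D → IsPeriodicPerm h k D (diagSeq (suc ℓ) c T)) (sym (+-assoc N (ℓ * N) t))
        (glue-periodic (blockSeq-periodic coprime c) (diagSeq-periodic ℓ c<k T-periodic (λ _ → T-junction z<s))
          (inj₁ ≤-refl) (m≤m+n N _) ≤-refl junction)
      where
      starts-at-c : ∀ ℓ → 0 < ℓ * N + t → diagSeq ℓ c T 0 ≡ c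
      starts-at-c zero    0<t = T-junction z<s 0<t
      starts-at-c (suc ℓ) _   = diagSeq-zero ℓ (<-trans c<k k<N)
      junction : 0 < ℓ * N + t → Step h k (blockSeq c (N ∸ 1)) (N + diagSeq ℓ c T 0)
      junction 0<d = subst (λ x → Step h k _ (N + x)) (sym (starts-at-c ℓ 0<d)) (lower-junction-step c<k)

    antidiagSeq-periodic : ∀ ℓ {t c T} → k ≤ c → c < N → IsPeriodicPerm h k t T → (0 < ℓ → 0 < t → T 0 + N ≡ t + c) →
                           IsPeriodicPerm h k (ℓ * N + t) (antidiagSeq ℓ c t T)
    antidiagSeq-periodic zero k≤c c<N T-periodic _ = T-periodic
    antidiagSeq-periodic (suc ℓ) {t} {c} {T} k≤c c<N T-periodic T-junction =
      subst (λ D → IsPeriodicPerm h k D (antidiagSeq (suc ℓ) c t T)) (sym (+-assoc N (ℓ * N) t))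
        (glue-periodic (blockSeq-periodic coprime c)
            (antidiagSeq-periodic ℓ k≤c c<N T-periodic (λ _ → T-junction z<s))
          (inj₂ ≤-refl) (≤-reflexive (+-comm (ℓ * N + t) N)) (m≤n+m _ N) junction)
      where
      regroup : ∀ a b c N → a + b + c + N ≡ N + a + b + c
      regroup = solve-∀
      starts-below : ∀ ℓ → 0 < ℓ * N + t → antidiagSeq ℓ c t T 0 + N ≡ ℓ * N + t + c
      starts-below zero    0<t = T-junction z<s 0<t
      starts-below (suc ℓ) _   = trans (cong (_+ N) (antidiagSeq-zero ℓ c<N)) (regroup (ℓ * N) t c N)
      junction : 0 < ℓ * N + t → Step h k (ℓ * N + t + blockSeq c (N ∸ 1)) (antidiagSeq ℓ c t T 0)
      junction 0<d = upper-junction-step k≤c c<N (starts-below ℓ 0<d)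

    diag-IsPPM : ∀ ℓ {d c t T} rest {M : Fin d → Fin d → ℕ} → d ≡ ℓ * N + t → size rest ≡ t →
                 diag rest ≈[ size rest ] permMat T → IsPeriodicPerm h k t T → c < k → (0 < ℓ → 0 < t → T 0 ≡ c) →
                 M ≈M diag (copies ℓ (N , A h k (suc c)) ++ rest) → IsPPM h k d M
    diag-IsPPM ℓ rest refl refl rest≈T T-periodic c<k junction M≈ =
      periodicPerm⇒IsPPM (diagSeq-periodic ℓ c<k T-periodic junction) (≈M-permMat M≈ (diag-copies ℓ rest≈T))

    antidiag-IsPPM : ∀ ℓ {d m t T} rest {M : Fin d → Fin d → ℕ} → d ≡ ℓ * N + t → size rest ≡ t →
                     antidiag rest ≈[ size rest ] permMat T → IsPeriodicPerm h k t T → 1 ≤ m → m ≤ h →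
                     (0 < ℓ → 0 < t → T 0 + N ≡ t + bOffset m) →
                     M ≈M antidiag (copies ℓ (N , B h k m) ++ rest) → IsPPM h k d M
    antidiag-IsPPM ℓ {m = m} rest refl refl rest≈T T-periodic 1≤m m≤h junction M≈ =
      periodicPerm⇒IsPPM (antidiagSeq-periodic ℓ k≤c c<N T-periodic junction)
        (≈M-permMat M≈ (antidiag-copies ℓ {m} rest≈T (IsPeriodicPerm.bounded T-periodic)))
      where
      k≤c : k ≤ bOffset m
      k≤c = subst (k ≤_) (sym (bOffset-∸ 1≤m)) (subst (_≤ N ∸ m) (m+n∸m≡n h k) (∸-monoʳ-≤ N m≤h))
      c<N : bOffset m < N
      c<N = subst (_< N) (sym (bOffset-∸ 1≤m)) (∸-monoʳ-< 1≤m (≤-trans m≤h (m≤m+n h k)))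

    diag-copies-IsPPM : ∀ ℓ {d m} {M : Fin d → Fin d → ℕ} → d ≡ ℓ * N → 1 ≤ m → m ≤ k →
                        M ≈M diag (copies ℓ (N , A h k m)) → IsPPM h k d M
    diag-copies-IsPPM ℓ {m = suc c} {M} d≡ _ c<k M≈ =
      diag-IsPPM ℓ [] (trans d≡ (sym (+-identityʳ _))) refl (λ _ ()) (empty-periodic {σ = λ _ → 0}) c<k (λ _ ())
        (subst (λ bs → M ≈M diag bs) (sym (++-identityʳ (copies ℓ (N , A h k (suc c))))) M≈)

    antidiag-copies-IsPPM : ∀ ℓ {d m} {M : Fin d → Fin d → ℕ} → d ≡ ℓ * N → 1 ≤ m → m ≤ h →
                            M ≈M antidiag (copies ℓ (N , B h k m)) → IsPPM h k d M
    antidiag-copies-IsPPM ℓ {m = m} {M} d≡ 1≤m m≤h M≈ =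
      antidiag-IsPPM ℓ [] (trans d≡ (sym (+-identityʳ _))) refl (λ _ ())
          (empty-periodic {σ = λ _ → 0}) 1≤m m≤h (λ _ ())
        (subst (λ bs → M ≈M antidiag bs) (sym (++-identityʳ (copies ℓ (N , B h k m)))) M≈)

    Kseq : ℕ → ℕ
    Kseq i = blockSeq 0 (suc i) ∸ 1

    Kseq-periodic : IsPeriodicPerm h k (N ∸ 1) Kseq
    Kseq-periodic = drop-first (blockSeq-periodic coprime 0) (blockSeq-zero z<s)

    Kseq-bounded : Bounded (N ∸ 1) (N ∸ 1) Kseq
    Kseq-bounded = IsPeriodicPerm.bounded Kseq-periodic

    K≈Kseq : K h k ≈[ N ∸ 1 ] permMat Kseq
    K≈Kseq = K-≈ λ {i} i<n → sym (m+[n∸m]≡n (n≢0⇒n>0 λ eq →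
      0≢1+n (sym (blockSeq-injective coprime 0 (s≤s i<n) z<s (trans eq (sym (blockSeq-zero z<s)))))))

    0<N-1 : 0 < N ∸ 1
    0<N-1 = ≤-trans (s≤s z≤n) (m≤n+m k h′)

    k′+N≡N-1+k : k′ + N ≡ N ∸ 1 + k
    k′+N≡N-1+k = regroup h′ k′
      where
      regroup : ∀ h′ k′ → k′ + (suc h′ + suc k′) ≡ h′ + suc k′ + suc k′
      regroup = solve-∀

    Kseq-start : Kseq 0 ≡ k′
    Kseq-start = cong (_∸ 1) blockSeq-one

    K-start : ∀ {T : ℕ → ℕ} → (∀ {i} → i < N ∸ 1 → blockSeq 0 (suc i) ≡ suc (T i)) → T 0 ≡ k′
    K-start K≡T = suc-injective (trans (sym (K≡T 0<N-1)) blockSeq-one)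

    Listed≥2 : (d : ℕ) → (Fin d → Fin d → ℕ) → Set
    Listed≥2 d M =
      (∃ λ ℓ → d ≡ ℓ * (h + k) + 1 ×
        ((M ≈M diag (copies ℓ (h + k , A h k 1) ++ (1 , I) ∷ []))
         ⊎ (M ≈M antidiag (copies ℓ (h + k , B h k 1) ++ (1 , I) ∷ []))))
      ⊎ (∃ λ ℓ → d ≡ ℓ * (h + k) + (h + k ∸ 1) ×
        ((M ≈M diag (copies ℓ (h + k , A h k k) ++ (h + k ∸ 1 , K h k) ∷ []))
         ⊎ (M ≈M antidiag (copies ℓ (h + k , B h k h) ++ (h + k ∸ 1 , K h k) ∷ []))))
      ⊎ (∃ λ ℓ → ℓ ≥ 1 × d ≡ ℓ * (h + k) ×
        ((∃ λ m → 1 ≤ m × m ≤ k × M ≈M diag (copies ℓ (h + k , A h k m)))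
         ⊎ (∃ λ m → 1 ≤ m × m ≤ h × M ≈M antidiag (copies ℓ (h + k , B h k m)))))

    form⇒Listed≥2 : 2 ≤ h → 2 ≤ k → ∀ ℓ t {σ} {M : Fin (ℓ * N + t) → Fin (ℓ * N + t) → ℕ} →
                    t < N → 0 < ℓ * N + t → M ≈M permMat σ → Form ℓ t σ → Listed≥2 (ℓ * N + t) M
    form⇒Listed≥2 2≤h 2≤k ℓ t {M = M} t<N 0<d M≈σ (inj₁ (diagForm c c<k T T-periodic σ≗ junction))
      with tail-cases≥2 2≤h 2≤k T-periodic t<N
    ... | inj₁ refl = inj₂ (inj₂ (ℓ , 1≤ℓ 0<d , +-identityʳ _ , inj₁ (diag-copies-leaf ℓ M≈σ σ≗ c<k)))
    ... | inj₂ (inj₁ (refl , T0≡0)) =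
      inj₁ (ℓ , refl , inj₁ (diag-leaf ℓ ((1 , I) ∷ []) M≈σ refl (diag-single (I≈[1] {T} T0≡0) bounded) σ≗
        λ 0<ℓ → trans (sym (junction 0<ℓ z<s)) T0≡0))
      where open IsPeriodicPerm T-periodic
    ... | inj₂ (inj₂ (refl , K≡T)) =
      inj₂ (inj₁ (ℓ , refl , inj₁
          (diag-leaf ℓ ((N ∸ 1 , K h k) ∷ []) M≈σ (+-identityʳ _) (diag-single (K-≈ K≡T) bounded) σ≗
        λ 0<ℓ → trans (sym (junction 0<ℓ 0<N-1)) (K-start K≡T))))
      where open IsPeriodicPerm T-periodic
    form⇒Listed≥2 2≤h 2≤k ℓ t {M = M} t<N 0<d M≈σ (inj₂ (antidiagForm c k≤c c<N T T-periodic σ≗ junction))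
      with tail-cases≥2 2≤h 2≤k T-periodic t<N
    ... | inj₁ refl = inj₂ (inj₂ (ℓ , 1≤ℓ 0<d , +-identityʳ _ , inj₂ (antidiag-copies-leaf ℓ M≈σ σ≗ k≤c c<N)))
    ... | inj₂ (inj₁ (refl , T0≡0)) =
      inj₁ (ℓ , refl , inj₂
          (antidiag-leaf ℓ {m = 1} ((1 , I) ∷ []) M≈σ refl (antidiag-single (I≈[1] {T} T0≡0) bounded) bounded σ≗ c≡))
      where
      open IsPeriodicPerm T-periodic
      c≡ : 0 < ℓ → c ≡ bOffset 1
      c≡ 0<ℓ = trans (sym (suc-injective (trans (cong (_+ N) (sym T0≡0)) (junction 0<ℓ z<s)))) (sym bOffset-1)
    ... | inj₂ (inj₂ (refl , K≡T)) =
      inj₂ (inj₁ (ℓ , refl , inj₂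
          (antidiag-leaf ℓ {m = h} ((N ∸ 1 , K h k) ∷ []) M≈σ (+-identityʳ _) (antidiag-single (K-≈ K≡T) bounded)
        bounded σ≗ c≡)))
      where
      open IsPeriodicPerm T-periodic
      c≡ : 0 < ℓ → c ≡ bOffset h
      c≡ 0<ℓ = trans (sym (+-cancelˡ-≡ (N ∸ 1) k c (begin
        N ∸ 1 + k   ≡⟨ k′+N≡N-1+k ⟨
        k′ + N      ≡⟨ cong (_+ N) (K-start K≡T) ⟨
        T 0 + N     ≡⟨ junction 0<ℓ 0<N-1 ⟩
        N ∸ 1 + c   ∎))) (sym bOffset-h)

    Listed≥2⇒IsPPM : ∀ {d M} → Listed≥2 d M → IsPPM h k d M
    Listed≥2⇒IsPPM (inj₁ (ℓ , d≡ , inj₁ M≈)) =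
      diag-IsPPM ℓ ((1 , I) ∷ []) d≡ refl (diag-single (I-≈ λ _ → refl) id-bounded)
          (singleton-periodic refl) z<s (λ _ _ → refl) M≈
    Listed≥2⇒IsPPM (inj₁ (ℓ , d≡ , inj₂ M≈)) =
      antidiag-IsPPM ℓ ((1 , I) ∷ []) d≡ refl (antidiag-single (I-≈ λ _ → refl) id-bounded)
          (singleton-periodic refl) ≤-refl (s≤s z≤n) (λ _ _ → sym (cong suc bOffset-1)) M≈
    Listed≥2⇒IsPPM (inj₂ (inj₁ (ℓ , d≡ , inj₁ M≈))) =
      diag-IsPPM ℓ ((N ∸ 1 , K h k) ∷ []) d≡ (+-identityʳ _)
          (diag-single K≈Kseq Kseq-bounded) Kseq-periodic (n<1+n k′) (λ _ _ → Kseq-start) M≈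
    Listed≥2⇒IsPPM (inj₂ (inj₁ (ℓ , d≡ , inj₂ M≈))) =
      antidiag-IsPPM ℓ ((N ∸ 1 , K h k) ∷ []) d≡ (+-identityʳ _)
          (antidiag-single K≈Kseq Kseq-bounded) Kseq-periodic (s≤s z≤n) ≤-refl
          (λ _ _ → trans (cong (_+ N) Kseq-start) (trans k′+N≡N-1+k (cong (N ∸ 1 +_) (sym bOffset-h)))) M≈
    Listed≥2⇒IsPPM (inj₂ (inj₂ (ℓ , _ , d≡ , inj₁ (m , 1≤m , m≤k , M≈)))) = diag-copies-IsPPM ℓ d≡ 1≤m m≤k M≈
    Listed≥2⇒IsPPM (inj₂ (inj₂ (ℓ , _ , d≡ , inj₂ (m , 1≤m , m≤h , M≈)))) = antidiag-copies-IsPPM ℓ d≡ 1≤m m≤h M≈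

    classification≥2 : 2 ≤ h → 2 ≤ k → (d : ℕ) → d ≥ 1 → (M : Fin d → Fin d → ℕ) → IsPPM h k d M ⇔ Listed≥2 d M
    classification≥2 2≤h 2≤k d 1≤d M = mk⇔ (by-form Listed≥2 (form⇒Listed≥2 2≤h 2≤k) 1≤d) Listed≥2⇒IsPPM

-- The cases h = 1 and k = 1

module h≡1 (k′ : ℕ) (coprime : Coprime (1 + suc k′) (suc k′)) where
  open Cyclic 0 k′
  open Classification coprime

  c≡bOffset1 : ∀ {c} → k ≤ c → c < N → c ≡ bOffset 1
  c≡bOffset1 k≤c c<N = trans (≤-antisym (s≤s⁻¹ c<N) k≤c) (sym bOffset-1)

  reverse-bounded : ∀ {t} → Bounded t t (reverse t)
  reverse-bounded = IsPeriodicPerm.bounded (reverse-periodic {k = k})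

  Listed : (d : ℕ) → (Fin d → Fin d → ℕ) → Set
  Listed d M =
    (∃ λ ℓ → ∃ λ m → 1 ≤ m × m ≤ k × d ≡ ℓ * (h + k) + m ×
      ((M ≈M diag (copies ℓ (h + k , A h k m) ++ (m , J m) ∷ []))
       ⊎ (M ≈M antidiag (copies ℓ (h + k , B h k 1) ++ (m , J m) ∷ []))))
    ⊎ (∃ λ ℓ → ℓ ≥ 1 × d ≡ ℓ * (h + k) ×
      ((∃ λ m → 1 ≤ m × m ≤ k × M ≈M diag (copies ℓ (h + k , A h k m)))
       ⊎ (M ≈M antidiag (copies ℓ (h + k , B h k 1)))))

  form⇒Listed : ∀ ℓ t {σ} {M : Fin (ℓ * N + t) → Fin (ℓ * N + t) → ℕ} →
                t < N → 0 < ℓ * N + t → M ≈M permMat σ → Form ℓ t σ → Listed (ℓ * N + t) M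
  form⇒Listed ℓ zero _ 0<d M≈σ (inj₁ (diagForm c c<k T _ σ≗ _)) =
    inj₂ (ℓ , 1≤ℓ 0<d , +-identityʳ _ , inj₁ (diag-copies-leaf ℓ M≈σ σ≗ c<k))
  form⇒Listed ℓ (suc t) t<N _ M≈σ (inj₁ (diagForm c c<k T T-periodic σ≗ junction)) =
    inj₁ (ℓ , suc t , s≤s z≤n , s≤s⁻¹ t<N , refl ,
      inj₁ (diag-leaf ℓ ((suc t , J (suc t)) ∷ []) M≈σ (+-identityʳ _) (diag-single (J-≈ tail) bounded) σ≗
        λ 0<ℓ → trans (sym (junction 0<ℓ z<s)) (tail z<s)))
    where
    open IsPeriodicPerm T-periodic
    tail : ∀ {i} → i < suc t → i + T i ≡ t
    tail = reversed-tail T-periodic (s≤s⁻¹ t<N)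
  form⇒Listed ℓ zero {M = M} _ 0<d M≈σ (inj₂ (antidiagForm c k≤c c<N T _ σ≗ _)) =
    inj₂ (ℓ , 1≤ℓ 0<d , +-identityʳ _ , inj₂ (subst (λ bs → M ≈M antidiag bs) (++-identityʳ (copies ℓ (N , B h k 1)))
      (antidiag-leaf ℓ {m = 1} [] M≈σ refl (λ _ ()) (λ ()) σ≗ λ _ → c≡bOffset1 k≤c c<N)))
  form⇒Listed ℓ (suc t) t<N _ M≈σ (inj₂ (antidiagForm c k≤c c<N T T-periodic σ≗ junction)) =
    inj₁ (ℓ , suc t , s≤s z≤n , s≤s⁻¹ t<N , refl ,
      inj₂ (antidiag-leaf ℓ {m = 1} ((suc t , J (suc t)) ∷ []) M≈σ (+-identityʳ _)
        (antidiag-single (J-≈ (reversed-tail T-periodic (s≤s⁻¹ t<N))) bounded) bounded σ≗ λ _ → c≡bOffset1 k≤c c<N))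
    where open IsPeriodicPerm T-periodic

  Listed⇒IsPPM : ∀ {d M} → Listed d M → IsPPM h k d M
  Listed⇒IsPPM (inj₁ (ℓ , suc c , _ , c<k , d≡ , inj₁ M≈)) =
    diag-IsPPM ℓ ((suc c , J (suc c)) ∷ []) d≡ (+-identityʳ _)
        (diag-single J≈reverse reverse-bounded) reverse-periodic c<k (λ _ _ → refl) M≈
  Listed⇒IsPPM (inj₁ (ℓ , suc m , _ , _ , d≡ , inj₂ M≈)) =
    antidiag-IsPPM ℓ ((suc m , J (suc m)) ∷ []) d≡ (+-identityʳ _)
        (antidiag-single J≈reverse reverse-bounded) reverse-periodic
        ≤-refl ≤-refl (λ _ _ → trans (+-suc m (N ∸ 1)) (cong (suc m +_) (sym bOffset-1))) M≈
  Listed⇒IsPPM (inj₂ (ℓ , _ , d≡ , inj₁ (m , 1≤m , m≤k , M≈))) = diag-copies-IsPPM ℓ d≡ 1≤m m≤k M≈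
  Listed⇒IsPPM (inj₂ (ℓ , _ , d≡ , inj₂ M≈)) = antidiag-copies-IsPPM ℓ d≡ ≤-refl ≤-refl M≈

  classification : (d : ℕ) → d ≥ 1 → (M : Fin d → Fin d → ℕ) → IsPPM h k d M ⇔ Listed d M
  classification d 1≤d M = mk⇔ (by-form Listed form⇒Listed 1≤d) Listed⇒IsPPM

module k≡1 (h′ : ℕ) (coprime : Coprime (suc h′ + 1) 1) where
  open Cyclic h′ 0
  open Classification coprime

  Listed : (d : ℕ) → (Fin d → Fin d → ℕ) → Set
  Listed d M =
    (∃ λ ℓ → ∃ λ m → 1 ≤ m × m ≤ h × d ≡ ℓ * (h + k) + m ×
      ((M ≈M diag (copies ℓ (h + k , A h k 1) ++ (m , I) ∷ []))
       ⊎ (M ≈M antidiag (copies ℓ (h + k , B h k m) ++ (m , I) ∷ []))))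
    ⊎ (∃ λ ℓ → ℓ ≥ 1 × d ≡ ℓ * (h + k) ×
      ((M ≈M diag (copies ℓ (h + k , A h k 1)))
       ⊎ (∃ λ m → 1 ≤ m × m ≤ h × M ≈M antidiag (copies ℓ (h + k , B h k m)))))

  t<N⇒t≤h : ∀ {t} → t < N → t ≤ h
  t<N⇒t≤h {t} t<N = subst (t ≤_) (+-comm h′ 1) (s≤s⁻¹ t<N)

  form⇒Listed : ∀ ℓ t {σ} {M : Fin (ℓ * N + t) → Fin (ℓ * N + t) → ℕ} →
                t < N → 0 < ℓ * N + t → M ≈M permMat σ → Form ℓ t σ → Listed (ℓ * N + t) M
  form⇒Listed ℓ zero {M = M} _ 0<d M≈σ (inj₁ (diagForm c c<k T _ σ≗ _)) =
    inj₂ (ℓ , 1≤ℓ 0<d , +-identityʳ _ , inj₁ (subst (λ bs → M ≈M diag bs) (++-identityʳ (copies ℓ (N , A h k 1)))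
      (diag-leaf ℓ [] M≈σ refl (λ _ ()) σ≗ λ _ → n<1⇒n≡0 c<k)))
  form⇒Listed ℓ (suc t) t<N _ M≈σ (inj₁ (diagForm c c<k T T-periodic σ≗ _)) =
    inj₁ (ℓ , suc t , s≤s z≤n , t<N⇒t≤h t<N , refl ,
      inj₁ (diag-leaf ℓ ((suc t , I) ∷ []) M≈σ (+-identityʳ _)
          (diag-single (I-≈ (identity-tail T-periodic (t<N⇒t≤h t<N))) bounded) σ≗
        λ _ → n<1⇒n≡0 c<k))
    where open IsPeriodicPerm T-periodic
  form⇒Listed ℓ zero _ 0<d M≈σ (inj₂ (antidiagForm c k≤c c<N T _ σ≗ _)) =
    inj₂ (ℓ , 1≤ℓ 0<d , +-identityʳ _ , inj₂ (antidiag-copies-leaf ℓ M≈σ σ≗ k≤c c<N))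
  form⇒Listed ℓ (suc t) t<N _ M≈σ (inj₂ (antidiagForm c k≤c c<N T T-periodic σ≗ junction)) =
    inj₁ (ℓ , suc t , s≤s z≤n , t<N⇒t≤h t<N , refl ,
      inj₂ (antidiag-leaf ℓ {m = suc t} ((suc t , I) ∷ []) M≈σ (+-identityʳ _)
          (antidiag-single (I-≈ tail) bounded) bounded σ≗ c≡))
    where
    open IsPeriodicPerm T-periodic
    tail : ∀ {i} → i < suc t → T i ≡ i
    tail = identity-tail T-periodic (t<N⇒t≤h t<N)
    c≡ : 0 < ℓ → c ≡ bOffset (suc t)
    c≡ 0<ℓ = begin
      c                  ≡⟨ m+n∸m≡n (suc t) c ⟨
      suc t + c ∸ suc t  ≡⟨ cong (_∸ suc t) (trans (cong (_+ N) (sym (tail z<s))) (junction 0<ℓ z<s)) ⟨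
      N ∸ suc t          ≡⟨ bOffset-∸ {suc t} (s≤s z≤n) ⟨
      bOffset (suc t)    ∎

  Listed⇒IsPPM : ∀ {d M} → Listed d M → IsPPM h k d M
  Listed⇒IsPPM (inj₁ (ℓ , m , _ , _ , d≡ , inj₁ M≈)) =
    diag-IsPPM ℓ ((m , I) ∷ []) d≡ (+-identityʳ _)
        (diag-single (I-≈ λ _ → refl) id-bounded) identity-periodic z<s (λ _ _ → refl) M≈
  Listed⇒IsPPM (inj₁ (ℓ , m , 1≤m , m≤h , d≡ , inj₂ M≈)) =
    antidiag-IsPPM ℓ ((m , I) ∷ []) d≡ (+-identityʳ _)
        (antidiag-single (I-≈ λ _ → refl) id-bounded) identity-periodic 1≤m m≤h
        (λ _ _ → sym (trans (cong (m +_) (bOffset-∸ 1≤m)) (m+[n∸m]≡n (≤-trans m≤h (m≤m+n h k))))) M≈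
  Listed⇒IsPPM (inj₂ (ℓ , _ , d≡ , inj₁ M≈)) = diag-copies-IsPPM ℓ d≡ ≤-refl ≤-refl M≈
  Listed⇒IsPPM (inj₂ (ℓ , _ , d≡ , inj₂ (m , 1≤m , m≤h , M≈))) = antidiag-copies-IsPPM ℓ d≡ 1≤m m≤h M≈

  classification : (d : ℕ) → d ≥ 1 → (M : Fin d → Fin d → ℕ) → IsPPM h k d M ⇔ Listed d M
  classification d 1≤d M = mk⇔ (by-form Listed form⇒Listed 1≤d) Listed⇒IsPPM

coprime-sum : ∀ h k → gcd h k ≡ 1 → Coprime (h + k) k
coprime-sum h k gcd≡1 = subst (λ n → Coprime n k) (+-comm k h) (coprime-+ (gcd≡1⇒coprime gcd≡1))

proposition1 : (h k : ℕ) → h ≥ 1 → k ≥ 1 → gcd h k ≡ 1 →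
  ((h ≥ 2 → k ≥ 2 → (d : ℕ) → d ≥ 1 → (M : Fin d → Fin d → ℕ) →
      IsPPM h k d M ⇔
        ((∃ λ ℓ → d ≡ ℓ * (h + k) + 1 ×
            ((M ≈M diag (copies ℓ (h + k , A h k 1) ++ (1 , I) ∷ []))
             ⊎ (M ≈M antidiag (copies ℓ (h + k , B h k 1) ++ (1 , I) ∷ []))))
        ⊎ (∃ λ ℓ → d ≡ ℓ * (h + k) + (h + k ∸ 1) ×
            ((M ≈M diag (copies ℓ (h + k , A h k k) ++ (h + k ∸ 1 , K h k) ∷ []))
             ⊎ (M ≈M antidiag (copies ℓ (h + k , B h k h) ++ (h + k ∸ 1 , K h k) ∷ []))))
        ⊎ (∃ λ ℓ → ℓ ≥ 1 × d ≡ ℓ * (h + k) ×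
            ((∃ λ m → 1 ≤ m × m ≤ k × M ≈M diag (copies ℓ (h + k , A h k m)))
             ⊎ (∃ λ m → 1 ≤ m × m ≤ h × M ≈M antidiag (copies ℓ (h + k , B h k m)))))))
  × (h ≡ 1 → (d : ℕ) → d ≥ 1 → (M : Fin d → Fin d → ℕ) →
      IsPPM h k d M ⇔
        ((∃ λ ℓ → ∃ λ m → 1 ≤ m × m ≤ k × d ≡ ℓ * (h + k) + m ×
            ((M ≈M diag (copies ℓ (h + k , A h k m) ++ (m , J m) ∷ []))
             ⊎ (M ≈M antidiag (copies ℓ (h + k , B h k 1) ++ (m , J m) ∷ []))))
        ⊎ (∃ λ ℓ → ℓ ≥ 1 × d ≡ ℓ * (h + k) ×
            ((∃ λ m → 1 ≤ m × m ≤ k × M ≈M diag (copies ℓ (h + k , A h k m)))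
             ⊎ (M ≈M antidiag (copies ℓ (h + k , B h k 1)))))))
  × (k ≡ 1 → (d : ℕ) → d ≥ 1 → (M : Fin d → Fin d → ℕ) →
      IsPPM h k d M ⇔
        ((∃ λ ℓ → ∃ λ m → 1 ≤ m × m ≤ h × d ≡ ℓ * (h + k) + m ×
            ((M ≈M diag (copies ℓ (h + k , A h k 1) ++ (m , I) ∷ []))
             ⊎ (M ≈M antidiag (copies ℓ (h + k , B h k m) ++ (m , I) ∷ []))))
        ⊎ (∃ λ ℓ → ℓ ≥ 1 × d ≡ ℓ * (h + k) ×
            ((M ≈M diag (copies ℓ (h + k , A h k 1)))
             ⊎ (∃ λ m → 1 ≤ m × m ≤ h × M ≈M antidiag (copies ℓ (h + k , B h k m))))))))
proposition1 (suc h′) (suc k′) _ _ gcd≡1 =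
  (λ 2≤h 2≤k → Cyclic.Classification.classification≥2 h′ k′ coprime 2≤h 2≤k) ,
  (λ { refl → h≡1.classification k′ coprime }) ,
  (λ { refl → k≡1.classification h′ coprime })
  where
  coprime : Coprime (suc h′ + suc k′) (suc k′)
  coprime = coprime-sum (suc h′) (suc k′) gcd≡1
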